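{- Let $\mathcal C$ be a social choice rule satisfying (Iso), (I), (GC) and (C). For a profile $\mathbb R$ on a finite set $X$ and nonempty $S\subseteq X$, write $\mathbb R'=\mathbb R|_S$ and define recursively $$C^{(CC)}(S;\mathbb R):=\begin{cases} C(S;\mathbb R) & \text{if no } B\subsetneq S \text{ is a component of } \mathbb R',\\ C^{(CC)}(S/B;\mathbb R'/B) & \text{if } B\subsetneq S \text{ is a component of } \mathbb R' \text{ and } B\notin C^{(CC)}(S/B;\mathbb R'/B),\\ \big(C^{(CC)}(S/B;\mathbb R'/B)\setminus\{B\}\big)\cup C^{(CC)}(B;\mathbb R') & \text{if } B\subsetneq S \text{ is a component of } \mathbb R' \text{ and } B\in C^{(CC)}(S/B;\mathbb R'/B).\end{cases}$$ Then this recursion defines a rule $\mathcal C^{(CC)}$ (i.e. the result does not depend on the choice of the proper component $B$), and: 1. $C^{(CC)}(S;\mathbb R)=C(S;\mathbb R)$ whenever no component of $\mathbb R'$ is properly contained in $S$; 2. $\mathcal C^{(CC)}$ satisfies (Iso), (I), (GC), (C) and (CC).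
   Context: Individuals form a finite set $N=\{1,\dots,n\}$, $n\ge 1$; a profile on a finite set $X$ is $\mathbb R=(R_1,\dots,R_n)$ with each $R_i$ a reflexive binary relation on $X$. A social choice rule $\mathcal C$ assigns to every profile $\mathbb R$ (with any number of individuals) on any finite set $X$ and every nonempty $S\subseteq X$ a nonempty $C(S;\mathbb R)\subseteq S$. Restriction: $\mathbb R|_S=(R_1\cap(S\times S),\dots,R_n\cap(S\times S))$. An isomorphism between profiles $\mathbb R$ on $X$ (individuals $N$) and $\mathbb R^*$ on $X^*$ (individuals $N^*$) is a bijection $\varphi:X\to X^*$ for which there is a bijection $\psi:N\to N^*$ with $xR_iy\iff\varphi(x)R^*_{\psi(i)}\varphi(y)$ for all $x,y,i$. (Iso): $C(\varphi[S];\mathbb R^*)=\varphi[C(S;\mathbb R)]$ whenever $\varphi$ is such an isomorphism. (I): $C(S;\mathbb R)=C(S;\mathbb R|_S)$. (C): $C(S)=\{x\}$ whenever $x\in S$ and $C(\{x,y\})=\{x\}$ for all $y\in S$. (GC): $x\in C(S)$ whenever $x\in S$ and $x\in C(\{x,y\})$ for all $y\in S$. A component of a reflexive relation $R$ on $X$ is a set $B\subseteq X$ with $|B|\ge2$ such that for every $x\in X\setminus B$: if $xRy$ for some $y\in B$ then $xRy$ for all $y\in B$, and if $yRx$ for some $y\in B$ then $yRx$ for all $y\in B$. A component of a profile $\mathbb R$ is a common component of all $R_i$. Quotient: for $B\subseteq X$ let $X/B:=(X\setminus B)\cup\{B\}$ (with $B$ treated as a single new element) and for $S\supseteq B$, $S/B:=(S\setminus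 B)\cup\{B\}$. The quotient profile $\mathbb R/B=(R_1/B,\dots,R_n/B)$ on $X/B$ is given by: for $x,y\in X/B$, $x\,(R_i/B)\,y$ iff either $x,y\ne B$ and $xR_iy$; or $x=y=B$; or $x=B\ne y$ and $zR_iy$ for all $z\in B$; or $x\ne B=y$ and $xR_iz$ for all $z\in B$. (CC): for every profile $\mathbb R$ on $X$, nonempty $S\subseteq X$ and every component $B\subseteq S$ of $\mathbb R$: $C(S;\mathbb R)=C(S/B;\mathbb R/B)$ if $B\notin C(S/B;\mathbb R/B)$, and $C(S;\mathbb R)=(C(S/B;\mathbb R/B)\setminus\{B\})\cup C(B;\mathbb R)$ if $B\in C(S/B;\mathbb R/B)$. -}

module Defs where

open import Data.Bool using (Bool; true; false; T; not; _∧_; _∨_; if_then_else_)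
open import Data.Bool.Properties using (T?; T-irrelevant)
open import Data.Nat using (ℕ; _≤_)
open import Data.Fin using (Fin)
open import Data.Unit using (⊤; tt)
open import Data.Empty using (⊥)
open import Data.Product using (Σ; Σ-syntax; ∃; ∃-syntax; _×_; _,_; proj₁; proj₂)
open import Data.Sum using (_⊎_; inj₁; inj₂)
open import Data.List using (List; []; _∷_; _++_; map)
open import Data.List.Membership.Propositional using (_∈_)
open import Data.List.Relation.Unary.Any using (here; there)
open import Data.List.Membership.Propositional.Properties using (∈-++⁺ˡ; ∈-++⁺ʳ; ∈-map⁺)
open import Relation.Nullary using (¬_; Dec; yes; no)
open import Relation.Nullary.Decidable using (⌊_⌋)
open import Relation.Binary.Definitions using (DecidableEquality)
open import Relation.Binary.PropositionalEquality using (_≡_; refl; cong)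
open import Function.Bundles using (_↔_; Inverse)

record FinSet : Set₁ where
  field
    Carrier  : Set
    _≟_      : DecidableEquality Carrier
    enum     : List Carrier
    complete : ∀ x → x ∈ enum

open FinSet public

record Subset (F : FinSet) : Set where
  constructor ⟨_⟩
  field mem : Carrier F → Bool

open Subset public

module _ {F : FinSet} where

  _∈ₛ_ : Carrier F → Subset F → Set
  x ∈ₛ S = T (mem S x)

  Nonempty : Subset F → Set
  Nonempty S = ∃[ x ] (x ∈ₛ S)

  _⊆ₛ_ : Subset F → Subset F → Set
  S ⊆ₛ S' = ∀ x → x ∈ₛ S → x ∈ₛ S'

  _≐_ : Subset F → Subset F → Set
  S ≐ S' = ∀ x → mem S x ≡ mem S' x

  _∪_ : Subset F → Subset F → Subset F
  S ∪ S' = ⟨ (λ x → mem S x ∨ mem S' x) ⟩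

  fullₛ : Subset F
  fullₛ = ⟨ (λ _ → true) ⟩

  single : Carrier F → Subset F
  single x = ⟨ (λ z → ⌊ _≟_ F z x ⌋) ⟩

  pair : Carrier F → Carrier F → Subset F
  pair x y = ⟨ (λ z → ⌊ _≟_ F z x ⌋ ∨ ⌊ _≟_ F z y ⌋) ⟩

subEnum : {A : Set} (S : A → Bool) → List A → List (Σ A (λ x → T (S x)))
subEnum S [] = []
subEnum S (x ∷ xs) with T? (S x)
... | yes p = (x , p) ∷ subEnum S xs
... | no _  = subEnum S xs

subEnum-complete : {A : Set} (S : A → Bool) (xs : List A) (x : A) (p : T (S x)) →
                   x ∈ xs → (x , p) ∈ subEnum S xs
subEnum-complete S (y ∷ xs) x p (here refl) with T? (S x)
... | yes q rewrite T-irrelevant p q = here refl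
... | no ¬q = Data.Empty.⊥-elim (¬q p)
  where import Data.Empty
subEnum-complete S (y ∷ xs) x p (there x∈) with T? (S y)
... | yes _ = there (subEnum-complete S xs x p x∈)
... | no _  = subEnum-complete S xs x p x∈

Sub : (F : FinSet) → Subset F → FinSet
Sub F S = record
  { Carrier  = Σ (Carrier F) (λ x → T (mem S x))
  ; _≟_      = dec
  ; enum     = subEnum (mem S) (enum F)
  ; complete = λ { (x , p) → subEnum-complete (mem S) (enum F) x p (complete F x) }
  }
  where
  dec : DecidableEquality (Σ (Carrier F) (λ x → T (mem S x)))
  dec (x , p) (y , q) with _≟_ F x y
  ... | yes refl rewrite T-irrelevant p q = yes refl
  ... | no x≢y = no (λ eq → x≢y (cong proj₁ eq))

liftSub : {F : FinSet} (S : Subset F) → Subset (Sub F S) → Subset F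
liftSub S U = ⟨ f ⟩
  where
  f : _
  f x with T? (mem S x)
  ... | yes p = mem U (x , p)
  ... | no _  = false

-- Quotient set  X/B = (X \ B) ∪ {B},  the new element B being inj₂ tt.

Quot : (F : FinSet) → Subset F → FinSet
Quot F B = record
  { Carrier  = Carrier (Sub F ⟨ (λ x → not (mem B x)) ⟩) ⊎ ⊤
  ; _≟_      = dec
  ; enum     = inj₂ tt ∷ map inj₁ (enum (Sub F ⟨ (λ x → not (mem B x)) ⟩))
  ; complete = λ { (inj₁ x) → there (∈-map⁺ inj₁ (complete (Sub F ⟨ (λ x → not (mem B x)) ⟩) x))
                 ; (inj₂ tt) → here refl }
  }
  where
  G = Sub F ⟨ (λ x → not (mem B x)) ⟩
  dec : DecidableEquality (Carrier G ⊎ ⊤)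
  dec (inj₁ x) (inj₁ y) with _≟_ G x y
  ... | yes refl = yes refl
  ... | no x≢y = no (λ { refl → x≢y refl })
  dec (inj₁ x) (inj₂ tt) = no (λ ())
  dec (inj₂ tt) (inj₁ y) = no (λ ())
  dec (inj₂ tt) (inj₂ tt) = yes refl

⋆ : {F : FinSet} {B : Subset F} → Carrier (Quot F B)
⋆ = inj₂ tt

-- S/B = (S \ B) ∪ {B}   (used for B ⊆ S)
quotS : {F : FinSet} (S B : Subset F) → Subset (Quot F B)
quotS S B = ⟨ f ⟩
  where
  f : _
  f (inj₁ (x , _)) = mem S x
  f (inj₂ tt)      = true

-- a subset U of X/B, viewed as a subset of X after removing the element B:
-- U \ {B}  ⊆ X \ B
unquot : {F : FinSet} (B : Subset F) → Subset (Quot F B) → Subset F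
unquot B U = ⟨ f ⟩
  where
  f : _
  f x with T? (not (mem B x))
  ... | yes p = mem U (inj₁ (x , p))
  ... | no _  = false

-- The right-hand side of (CC):
--   U                     if B ∉ U
--   (U \ {B}) ∪ V         if B ∈ U
recombine : {F : FinSet} (B : Subset F) → Subset (Quot F B) → Subset F → Subset F
recombine {F} B U V = if mem U (⋆ {F} {B}) then (unquot B U ∪ V) else unquot B U

BRel : FinSet → Set
BRel F = Carrier F → Carrier F → Bool

record Profile (F : FinSet) : Set where
  field
    n      : ℕ
    n≥1    : 1 ≤ n
    R      : Fin n → BRel F
    R-refl : ∀ i x → T (R i x x)

open Profile public

restrict : {F : FinSet} → Profile F → (S : Subset F) → Profile (Sub F S)
restrict P S = record
  { n = n P ; n≥1 = n≥1 P
  ; R = λ i x y → R P i (proj₁ x) (proj₁ y)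
  ; R-refl = λ i x → R-refl P i (proj₁ x) }

allB : {A : Set} → (A → Bool) → List A → Bool
allB f [] = true
allB f (x ∷ xs) = f x ∧ allB f xs

allIn : (F : FinSet) → Subset F → (Carrier F → Bool) → Bool
allIn F B f = allB (λ z → not (mem B z) ∨ f z) (enum F)

quotRel : {F : FinSet} (B : Subset F) → BRel F → BRel (Quot F B)
quotRel B R (inj₁ x) (inj₁ y) = R (proj₁ x) (proj₁ y)
quotRel B R (inj₂ tt) (inj₂ tt) = true
quotRel {F} B R (inj₂ tt) (inj₁ y) = allIn F B (λ z → R z (proj₁ y))
quotRel {F} B R (inj₁ x) (inj₂ tt) = allIn F B (λ z → R (proj₁ x) z)

quotP : {F : FinSet} → Profile F → (B : Subset F) → Profile (Quot F B)
quotP P B = record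
  { n = n P ; n≥1 = n≥1 P
  ; R = λ i → quotRel B (R P i)
  ; R-refl = λ { i (inj₁ x) → R-refl P i (proj₁ x) ; i (inj₂ tt) → tt } }

IsComponentRel : {F : FinSet} → BRel F → Subset F → Set
IsComponentRel {F} R B =
  (∃[ x ] ∃[ y ] (¬ x ≡ y × x ∈ₛ B × y ∈ₛ B)) ×
  (∀ x → ¬ (x ∈ₛ B) →
     ((∃[ y ] (y ∈ₛ B × T (R x y))) → ∀ y → y ∈ₛ B → T (R x y)) ×
     ((∃[ y ] (y ∈ₛ B × T (R y x))) → ∀ y → y ∈ₛ B → T (R y x)))

IsComponent : {F : FinSet} → Profile F → Subset F → Set
IsComponent P B = ∀ i → IsComponentRel (R P i) B

-- Social choice rules (values on the empty set are irrelevant junk).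

RuleFun : Set₁
RuleFun = (F : FinSet) → Profile F → Subset F → Subset F

IsRule : RuleFun → Set₁
IsRule C = ∀ F P (S : Subset F) → Nonempty S → Nonempty (C F P S) × (C F P S ⊆ₛ S)

image : {F F* : FinSet} → (Carrier F ↔ Carrier F*) → Subset F → Subset F*
image φ S = ⟨ (λ y → mem S (Inverse.from φ y)) ⟩

IsProfileIso : {F F* : FinSet} (P : Profile F) (P* : Profile F*) →
               (Carrier F ↔ Carrier F*) → Set
IsProfileIso P P* φ =
  Σ[ ψ ∈ (Fin (n P) ↔ Fin (n P*)) ]
    (∀ x y i → R P i x y ≡ R P* (Inverse.to ψ i) (Inverse.to φ x) (Inverse.to φ y))

Iso : RuleFun → Set₁
Iso C = ∀ F F* (P : Profile F) (P* : Profile F*) (φ : Carrier F ↔ Carrier F*) →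
        IsProfileIso P P* φ → ∀ (S : Subset F) → Nonempty S →
        C F* P* (image φ S) ≐ image φ (C F P S)

Indep : RuleFun → Set₁
Indep C = ∀ F P (S : Subset F) → Nonempty S →
          C F P S ≐ liftSub S (C (Sub F S) (restrict P S) fullₛ)

Condorcet : RuleFun → Set₁
Condorcet C = ∀ F P (S : Subset F) x → x ∈ₛ S →
              (∀ y → y ∈ₛ S → C F P (pair x y) ≐ single x) →
              C F P S ≐ single x

GenCondorcet : RuleFun → Set₁
GenCondorcet C = ∀ F P (S : Subset F) x → x ∈ₛ S →
                 (∀ y → y ∈ₛ S → x ∈ₛ C F P (pair x y)) →
                 x ∈ₛ C F P S

CompCons : RuleFun → Set₁
CompCons C = ∀ F P (S B : Subset F) → Nonempty S → B ⊆ₛ S → IsComponent P B →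
             C F P S ≐ recombine B (C (Quot F B) (quotP P B) (quotS S B)) (C F P B)

ProperComponentOf : {F : FinSet} → Profile F → (S : Subset F) → Subset (Sub F S) → Set
ProperComponentOf P S B = (∃[ s ] ¬ (s ∈ₛ B)) × IsComponent (restrict P S) B

RecBase : RuleFun → RuleFun → Set₁
RecBase C C' = ∀ F P (S : Subset F) → Nonempty S →
               ¬ (∃[ B ] ProperComponentOf P S B) →
               C' F P S ≐ C F P S

-- second and third clause, for EVERY proper component B of ℝ'
RecStep : RuleFun → Set₁
RecStep C' = ∀ F P (S : Subset F) → Nonempty S →
             ∀ B → ProperComponentOf P S B →
             C' F P S ≐
               liftSub S (recombine B
                 (C' (Quot (Sub F S) B) (quotP (restrict P S) B) fullₛ)
                 (C' (Sub F S) (restrict P S) B))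

-- The quotient S/M is never formed: a proper component M of ℝ|S is collapsed, inside X, to one
-- representative m ∈ M, so S/M becomes (S ∖ M) ∪ {m}, where the right-hand side of (CC) is evaluated.
-- Recursing on |S| with a decided choice of component and representative defines Cᶜᶜ. Everything
-- rests on this choice being irrelevant, proved by induction on |S| together with invariance under
-- isomorphisms: two proper components are nested, disjoint or overlapping, and overlapping ones have
-- a union, intersection or difference that is again a proper component, except when |S| = 3, where
-- an explicit isomorphism between the two components settles it. The axioms of C then pass to Cᶜᶜ
-- by the same induction, and any rule obeying the recursion agrees with Cᶜᶜ by induction on |S|.

module Submission where

open import Defs
open import Data.Bool using (Bool; true; false; T; not; _∧_; _∨_; if_then_else_)
open import Data.Bool.Properties
  using (T?; T-irrelevant; T-≡; T-∧; T-∨; ∧-assoc; ∧-comm; ∧-idem; ∧-zeroʳ; ∨-comm; ∨-identityʳ)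
import Data.Bool.Properties as Bool
open import Data.Empty using (⊥-elim)
open import Data.Fin using (Fin; fromℕ<)
import Data.Fin.Properties as Fin
open import Data.List using (List; []; _∷_; _++_; map; length)
open import Data.List.Properties using (length-map)
open import Data.List.Membership.Propositional using (_∈_; lose)
open import Data.List.Membership.Propositional.Properties using (∈-++⁺ˡ; ∈-++⁺ʳ; ∈-map⁺)
open import Data.List.Relation.Unary.Any using (here; there; satisfied)
import Data.List.Relation.Unary.Any as Any
import Data.List.Relation.Unary.All as All
open import Data.Nat using (ℕ; zero; suc; _+_; _≤_; _<_; z≤n; s≤s; s≤s⁻¹)
open import Data.Nat.Induction using (<-wellFounded)
open import Data.Nat.Properties
  using (m≤m+n; m≤n+m; ≤-trans; ≤-refl; <-trans; <-≤-trans; ≤-<-trans; m≤n⇒m≤1+n; n≤1+n)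
open import Data.Product using (Σ; Σ-syntax; ∃; ∃-syntax; _×_; _,_; proj₁; proj₂)
open import Data.Sum using (_⊎_; inj₁; inj₂; [_,_]′)
import Data.Sum as Sum
open import Data.Unit using (tt)
open import Function using (id; _∘_; case_of_)
open import Function.Bundles using (_↔_; Inverse; Equivalence; mk↔ₛ′)
open import Function.Construct.Identity using (↔-id)
open import Function.Construct.Symmetry using (↔-sym)
open import Induction.WellFounded using (Acc; acc)
open import Relation.Binary.PropositionalEquality
open import Relation.Nullary using (¬_; Dec; yes; no)
open import Relation.Nullary.Decidable using (⌊_⌋; map′; ¬?; _×-dec_; _→-dec_; toWitness; fromWitness)
open import Relation.Unary using (Decidable)

T⇒≡true : ∀ {b} → T b → b ≡ true
T⇒≡true {b} = Equivalence.to (T-≡ {b})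

¬T⇒≡false : ∀ {b} → ¬ T b → b ≡ false
¬T⇒≡false {true} ¬t = ⊥-elim (¬t _)
¬T⇒≡false {false} _ = refl

T-∧⁺ : ∀ {a b} → T a → T b → T (a ∧ b)
T-∧⁺ {a} {b} ta tb = Equivalence.from (T-∧ {a} {b}) (ta , tb)

T-∧⁻ˡ : ∀ {a b} → T (a ∧ b) → T a
T-∧⁻ˡ {a} {b} = proj₁ ∘ Equivalence.to (T-∧ {a} {b})

T-∧⁻ʳ : ∀ {a b} → T (a ∧ b) → T b
T-∧⁻ʳ {a} {b} = proj₂ ∘ Equivalence.to (T-∧ {a} {b})

T-∨⁺ˡ : ∀ {a b} → T a → T (a ∨ b)
T-∨⁺ˡ {a} {b} = Equivalence.from (T-∨ {a} {b}) ∘ inj₁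

T-∨⁺ʳ : ∀ {a b} → T b → T (a ∨ b)
T-∨⁺ʳ {a} {b} = Equivalence.from (T-∨ {a} {b}) ∘ inj₂

T-∨⁻ : ∀ {a b} → T (a ∨ b) → T a ⊎ T b
T-∨⁻ {a} {b} = Equivalence.to (T-∨ {a} {b})

T-not⁺ : ∀ {a} → ¬ T a → T (not a)
T-not⁺ {true} ¬t = ¬t _
T-not⁺ {false} _ = _

T-not⁻ : ∀ {a} → T (not a) → ¬ T a
T-not⁻ {true} ()

T-injective : ∀ {a b} → (T a → T b) → (T b → T a) → a ≡ b
T-injective {true} {true} _ _ = refl
T-injective {true} {false} f _ = ⊥-elim (f _)
T-injective {false} {true} _ g = ⊥-elim (g _)
T-injective {false} {false} _ _ = refl

⌊≟⌋-refl : (F : FinSet) (x : Carrier F) → ⌊ _≟_ F x x ⌋ ≡ true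
⌊≟⌋-refl F x = T⇒≡true (fromWitness {a? = _≟_ F x x} refl)

⌊≟⌋-≢ : (F : FinSet) {x y : Carrier F} → ¬ x ≡ y → ⌊ _≟_ F x y ⌋ ≡ false
⌊≟⌋-≢ F {x} {y} x≢y = ¬T⇒≡false (x≢y ∘ toWitness {a? = _≟_ F x y})

module _ {F : FinSet} where

  ≐-refl : {S : Subset F} → S ≐ S
  ≐-refl _ = refl

  ≐-sym : {S S' : Subset F} → S ≐ S' → S' ≐ S
  ≐-sym e x = sym (e x)

  ≐-trans : {S S' S'' : Subset F} → S ≐ S' → S' ≐ S'' → S ≐ S''
  ≐-trans e e' x = trans (e x) (e' x)

  ≐⇒⊆ : {S S' : Subset F} → S ≐ S' → S ⊆ₛ S'
  ≐⇒⊆ e x = subst T (e x)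

  ⊆-antisym : {S S' : Subset F} → S ⊆ₛ S' → S' ⊆ₛ S → S ≐ S'
  ⊆-antisym f g x = T-injective (f x) (g x)

  ∈∉⇒≢ : (S : Subset F) {x y : Carrier F} → x ∈ₛ S → ¬ y ∈ₛ S → ¬ x ≡ y
  ∈∉⇒≢ S x∈S y∉S refl = y∉S x∈S

  _∩ₛ_ : Subset F → Subset F → Subset F
  A ∩ₛ B = ⟨ (λ x → mem A x ∧ mem B x) ⟩

  _∖ₛ_ : Subset F → Subset F → Subset F
  A ∖ₛ B = ⟨ (λ x → mem A x ∧ not (mem B x)) ⟩

  ∁ : Subset F → Subset F
  ∁ B = ⟨ (λ x → not (mem B x)) ⟩

  Nontrivial : Subset F → Set
  Nontrivial X = ∃[ a ] ∃[ b ] (¬ a ≡ b × a ∈ₛ X × b ∈ₛ X)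

  data Position (S M : Subset F) (x : Carrier F) : Set where
    inside  : x ∈ₛ M → Position S M x
    beside  : x ∈ₛ S → ¬ x ∈ₛ M → Position S M x
    outside : ¬ x ∈ₛ S → Position S M x

  position : (S M : Subset F) (x : Carrier F) → Position S M x
  position S M x with T? (mem M x) | T? (mem S x)
  ... | yes x∈M | _       = inside x∈M
  ... | no x∉M  | yes x∈S = beside x∈S x∉M
  ... | no _    | no x∉S  = outside x∉S

pair-view : (F : FinSet) (x y z : Carrier F) → z ∈ₛ pair {F} x y → z ≡ x ⊎ z ≡ y
pair-view F x y z z∈ = Sum.map (toWitness {a? = _≟_ F z x}) (toWitness {a? = _≟_ F z y}) (T-∨⁻ z∈)

all? : (F : FinSet) {P : Carrier F → Set} → Decidable P → Dec (∀ x → P x)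
all? F P? = map′ (λ ps x → All.lookup ps (complete F x)) (λ ps → All.tabulate (λ {x} _ → ps x))
                 (All.all? P? (enum F))

any? : (F : FinSet) {P : Carrier F → Set} → Decidable P → Dec (∃ P)
any? F P? = map′ satisfied (λ (x , px) → lose (complete F x) px) (Any.any? P? (enum F))

module _ {F : FinSet} where

  nontrivial? : (X : Subset F) → Dec (Nontrivial X)
  nontrivial? X = any? F (λ a → any? F (λ b → ¬? (_≟_ F a b) ×-dec T? (mem X a) ×-dec T? (mem X b)))

  trivial⇒≡ : (X : Subset F) → ¬ Nontrivial X → ∀ {c} → c ∈ₛ X → ∀ x → x ∈ₛ X → x ≡ c
  trivial⇒≡ X trivial {c} c∈X x x∈X with _≟_ F x c
  ... | yes x≡c = x≡c
  ... | no x≢c = ⊥-elim (trivial (x , c , x≢c , x∈X , c∈X))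

  ⊆-or-∖ : (A B : Subset F) → A ⊆ₛ B ⊎ ∃[ x ] (x ∈ₛ A × ¬ x ∈ₛ B)
  ⊆-or-∖ A B with any? F (λ x → T? (mem A x) ×-dec ¬? (T? (mem B x)))
  ... | yes witness = inj₂ witness
  ... | no none = inj₁ λ x x∈A → case T? (mem B x) of λ where
                                   (yes x∈B) → x∈B
                                   (no x∉B) → ⊥-elim (none (x , x∈A , x∉B))

  disjoint-or-∩ : (A B : Subset F) → (∀ x → x ∈ₛ A → ¬ x ∈ₛ B) ⊎ ∃[ x ] (x ∈ₛ A × x ∈ₛ B)
  disjoint-or-∩ A B with any? F (λ x → T? (mem A x) ×-dec T? (mem B x))
  ... | yes witness = inj₂ witness
  ... | no none = inj₁ λ x x∈A x∈B → none (x , x∈A , x∈B)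

overwrite : (F : FinSet) → Carrier F → Bool → Subset F → Subset F
overwrite F x b U = ⟨ (λ y → if ⌊ _≟_ F y x ⌋ then b else mem U y) ⟩

candidates : (F : FinSet) → List (Carrier F) → List (Subset F)
candidates F [] = ⟨ (λ _ → false) ⟩ ∷ []
candidates F (x ∷ xs) =
  map (overwrite F x true) (candidates F xs) ++ map (overwrite F x false) (candidates F xs)

overwrite-∈-candidates : (F : FinSet) {x : Carrier F} {xs : List (Carrier F)} (b : Bool) {U : Subset F} →
                         U ∈ candidates F xs → overwrite F x b U ∈ candidates F (x ∷ xs)
overwrite-∈-candidates F true U∈ = ∈-++⁺ˡ (∈-map⁺ _ U∈)
overwrite-∈-candidates F {xs = xs} false U∈ = ∈-++⁺ʳ (map _ (candidates F xs)) (∈-map⁺ _ U∈)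

candidates-complete : (F : FinSet) (M : Subset F) (xs : List (Carrier F)) →
                      ∃[ U ] (U ∈ candidates F xs × ∀ y → y ∈ xs → mem U y ≡ mem M y)
candidates-complete F M [] = _ , here refl , λ _ ()
candidates-complete F M (x ∷ xs) with candidates-complete F M xs
... | U , U∈ , U≡M = overwrite F x (mem M x) U , overwrite-∈-candidates F {xs = xs} (mem M x) U∈ , agrees
  where
  agrees : ∀ y → y ∈ x ∷ xs → mem (overwrite F x (mem M x) U) y ≡ mem M y
  agrees y y∈ with _≟_ F y x | y∈
  ... | yes refl | _ = refl
  ... | no y≢x | here y≡x = ⊥-elim (y≢x y≡x)
  ... | no _ | there y∈xs = U≡M y y∈xs

subsets : (F : FinSet) → List (Subset F)
subsets F = candidates F (enum F)

subsets-complete : (F : FinSet) (M : Subset F) → ∃[ U ] (U ∈ subsets F × U ≐ M)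
subsets-complete F M with candidates-complete F M (enum F)
... | U , U∈ , U≡M = U , U∈ , λ y → U≡M y (complete F y)

countᵇ : {A : Set} → (A → Bool) → List A → ℕ
countᵇ p [] = 0
countᵇ p (x ∷ xs) = if p x then suc (countᵇ p xs) else countᵇ p xs

module _ {A : Set} {p q : A → Bool} (p⇒q : ∀ x → T (p x) → T (q x)) where

  countᵇ-mono : ∀ xs → countᵇ p xs ≤ countᵇ q xs
  countᵇ-mono [] = z≤n
  countᵇ-mono (x ∷ xs) with p x in px | q x in qx
  ... | true  | true  = s≤s (countᵇ-mono xs)
  ... | true  | false = ⊥-elim (subst T qx (p⇒q x (subst T (sym px) _)))
  ... | false | true  = m≤n⇒m≤1+n (countᵇ-mono xs)
  ... | false | false = countᵇ-mono xs

  countᵇ-mono-< : ∀ {x xs} → x ∈ xs → T (q x) → ¬ T (p x) → countᵇ p xs < countᵇ q xs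
  countᵇ-mono-< {x} {x ∷ xs} (here refl) qx ¬px rewrite ¬T⇒≡false ¬px | T⇒≡true qx = s≤s (countᵇ-mono xs)
  countᵇ-mono-< {xs = y ∷ xs} (there x∈) qx ¬px with p y in py | q y in qy
  ... | true  | true  = s≤s (countᵇ-mono-< x∈ qx ¬px)
  ... | true  | false = ⊥-elim (subst T qy (p⇒q y (subst T (sym py) _)))
  ... | false | true  = ≤-trans (countᵇ-mono-< x∈ qx ¬px) (n≤1+n _)
  ... | false | false = countᵇ-mono-< x∈ qx ¬px

countᵇ-true : {A : Set} (xs : List A) → countᵇ (λ _ → true) xs ≡ length xs
countᵇ-true [] = refl
countᵇ-true (x ∷ xs) = cong suc (countᵇ-true xs)

length-subEnum : {A : Set} (p : A → Bool) (xs : List A) → length (subEnum p xs) ≡ countᵇ p xs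
length-subEnum p [] = refl
length-subEnum p (x ∷ xs) with T? (p x)
... | yes px rewrite T⇒≡true px = cong suc (length-subEnum p xs)
... | no ¬px rewrite ¬T⇒≡false ¬px = length-subEnum p xs

size : (F : FinSet) → Subset F → ℕ
size F S = countᵇ (mem S) (enum F)

module _ {F : FinSet} where

  size-mono : (S S' : Subset F) → S ⊆ₛ S' → size F S ≤ size F S'
  size-mono S S' S⊆S' = countᵇ-mono S⊆S' (enum F)

  size-mono-< : (S S' : Subset F) {x : Carrier F} → S ⊆ₛ S' → x ∈ₛ S' → ¬ x ∈ₛ S → size F S < size F S'
  size-mono-< S S' {x} S⊆S' = countᵇ-mono-< S⊆S' (complete F x)

  size-∁ : (B : Subset F) → Nontrivial B → suc (size F (∁ B)) < size F fullₛ
  size-∁ B (a , b , a≢b , a∈B , b∈B) =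
    ≤-<-trans (size-mono-< (∁ B) ∁B+a (λ _ → T-∨⁺ˡ) a∈∁B+a (λ a∈∁B → T-not⁻ a∈∁B a∈B))
              (size-mono-< ∁B+a fullₛ {b} (λ _ _ → _) _ b∉∁B+a)
    where
    ∁B+a = ∁ B ∪ single a

    a∈∁B+a : a ∈ₛ ∁B+a
    a∈∁B+a = T-∨⁺ʳ {mem (∁ B) a} (fromWitness {a? = _≟_ F a a} refl)

    b∉∁B+a : ¬ b ∈ₛ ∁B+a
    b∉∁B+a b∈ = [ (λ b∈∁B → T-not⁻ b∈∁B b∈B) , (λ b≡a → a≢b (sym (toWitness {a? = _≟_ F b a} b≡a))) ]′
                  (T-∨⁻ b∈)

size-Sub-full : (F : FinSet) (S : Subset F) → size (Sub F S) fullₛ ≡ size F S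
size-Sub-full F S = trans (countᵇ-true (enum (Sub F S))) (length-subEnum (mem S) (enum F))

size-Quot-full : (F : FinSet) (B : Subset F) → size (Quot F B) fullₛ ≡ suc (size F (∁ B))
size-Quot-full F B = cong suc (begin
  countᵇ (λ _ → true) (map inj₁ outside-B)  ≡⟨ countᵇ-true (map inj₁ outside-B) ⟩
  length (map inj₁ outside-B)               ≡⟨ length-map inj₁ outside-B ⟩
  length outside-B                          ≡⟨ length-subEnum (mem (∁ B)) (enum F) ⟩
  size F (∁ B)                              ∎)
  where
  open ≡-Reasoning
  outside-B = subEnum (mem (∁ B)) (enum F)

-- Proper components relative to a subset

Indiscernible : {A : Set} → (A → A → Bool) → A → A → A → Set
Indiscernible Rl x y z = (Rl x y ≡ Rl x z) × (Rl y x ≡ Rl z x)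

module _ {A : Set} (Rl : A → A → Bool) where

  Indiscernible-sym : ∀ {x y z} → Indiscernible Rl x y z → Indiscernible Rl x z y
  Indiscernible-sym (xy≡xz , yx≡zx) = sym xy≡xz , sym yx≡zx

  Indiscernible-trans : ∀ {x y z w} → Indiscernible Rl x y z → Indiscernible Rl x z w → Indiscernible Rl x y w
  Indiscernible-trans (xy≡xz , yx≡zx) (xz≡xw , zx≡wx) = trans xy≡xz xz≡xw , trans yx≡zx zx≡wx

record ProperComponentIn {F : FinSet} (P : Profile F) (S M : Subset F) : Set where
  constructor properComponent
  field
    M⊆S       : M ⊆ₛ S
    outsider  : ∃[ s ] (s ∈ₛ S × ¬ s ∈ₛ M)
    twoPoints : Nontrivial M
    uniform   : ∀ i x y z → x ∈ₛ S → ¬ x ∈ₛ M → y ∈ₛ M → z ∈ₛ M → Indiscernible (R P i) x y z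

  rep : Carrier F
  rep = proj₁ twoPoints

  rep∈M : rep ∈ₛ M
  rep∈M = proj₁ (proj₂ (proj₂ (proj₂ twoPoints)))

  another : ∀ m → m ∈ₛ M → ∃[ y ] (y ∈ₛ M × ¬ y ≡ m)
  another m m∈M with twoPoints
  ... | a , b , a≢b , a∈M , b∈M with _≟_ F a m
  ...   | yes refl = b , b∈M , λ b≡a → a≢b (sym b≡a)
  ...   | no a≢m   = a , a∈M , a≢m

open ProperComponentIn

module _ {F : FinSet} where

  properComponent? : (P : Profile F) (S M : Subset F) → Dec (ProperComponentIn P S M)
  properComponent? P S M =
    map′ (λ (sub , out , two , uni) → properComponent sub out two uni)
         (λ pc → M⊆S pc , outsider pc , twoPoints pc , uniform pc)
         (all? F (λ x → T? (mem M x) →-dec T? (mem S x))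
           ×-dec any? F (λ s → T? (mem S s) ×-dec ¬? (T? (mem M s)))
           ×-dec nontrivial? M
           ×-dec Fin.all? (λ i → all? F (λ x → all? F (λ y → all? F (λ z →
                   T? (mem S x) →-dec ¬? (T? (mem M x)) →-dec T? (mem M y) →-dec T? (mem M z) →-dec
                   (R P i x y Bool.≟ R P i x z) ×-dec (R P i y x Bool.≟ R P i z x))))))

  ProperComponentIn-resp-≐ : {P : Profile F} {S M M' : Subset F} → M ≐ M' →
                             ProperComponentIn P S M → ProperComponentIn P S M'
  ProperComponentIn-resp-≐ {M = M} {M'} M≐M' pc = record
    { M⊆S       = λ x x∈M' → M⊆S pc x (M'⊆M x x∈M')
    ; outsider  = let (s , s∈S , s∉M) = outsider pc in s , s∈S , s∉M ∘ M'⊆M s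
    ; twoPoints = let (a , b , a≢b , a∈M , b∈M) = twoPoints pc in a , b , a≢b , M⊆M' a a∈M , M⊆M' b b∈M
    ; uniform   = λ i x y z x∈S x∉M' y∈M' z∈M' →
                    uniform pc i x y z x∈S (x∉M' ∘ M⊆M' x) (M'⊆M y y∈M') (M'⊆M z z∈M') }
    where
    M⊆M' : M ⊆ₛ M'
    M⊆M' = ≐⇒⊆ {S = M} M≐M'
    M'⊆M : M' ⊆ₛ M
    M'⊆M = ≐⇒⊆ {S = M'} (≐-sym {S = M} M≐M')

  ∃-properComponent? : (P : Profile F) (S : Subset F) → Dec (∃ (ProperComponentIn P S))
  ∃-properComponent? P S =
    map′ satisfied
         (λ (M , pc) → let (U , U∈ , U≐M) = subsets-complete F M in
                       lose {P = ProperComponentIn P S} U∈ (ProperComponentIn-resp-≐ (≐-sym {S = U} U≐M) pc))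
         (Any.any? (properComponent? P S) (subsets F))

module _ {G : FinSet} (Rl : BRel G) (B : Subset G) where

  component-uniform : IsComponentRel Rl B →
                      ∀ x y z → ¬ x ∈ₛ B → y ∈ₛ B → z ∈ₛ B → Indiscernible Rl x y z
  component-uniform (_ , closed) x y z x∉B y∈B z∈B =
    T-injective (λ r → proj₁ (closed x x∉B) (y , y∈B , r) z z∈B)
                (λ r → proj₁ (closed x x∉B) (z , z∈B , r) y y∈B) ,
    T-injective (λ r → proj₂ (closed x x∉B) (y , y∈B , r) z z∈B)
                (λ r → proj₂ (closed x x∉B) (z , z∈B , r) y y∈B)

  uniform-component : Nontrivial B →
                      (∀ x y z → ¬ x ∈ₛ B → y ∈ₛ B → z ∈ₛ B → Indiscernible Rl x y z) →
                      IsComponentRel Rl B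
  uniform-component two uni = two , λ x x∉B →
    (λ (y , y∈B , r) z z∈B → subst T (proj₁ (uni x y z x∉B y∈B z∈B)) r) ,
    (λ (y , y∈B , r) z z∈B → subst T (proj₂ (uni x y z x∉B y∈B z∈B)) r)

someVoter : {F : FinSet} (P : Profile F) → Fin (n P)
someVoter P = fromℕ< (n≥1 P)

module _ {F : FinSet} {P : Profile F} where

  component⇒properComponent : {S B : Subset F} → B ⊆ₛ S → ∃[ s ] (s ∈ₛ S × ¬ s ∈ₛ B) → IsComponent P B →
                              ProperComponentIn P S B
  component⇒properComponent {B = B} B⊆S out comp = record
    { M⊆S = B⊆S ; outsider = out ; twoPoints = proj₁ (comp (someVoter P))
    ; uniform = λ i x y z _ → component-uniform (R P i) B (comp i) x y z }

  properComponent⇒component : {B : Subset F} → ProperComponentIn P fullₛ B →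
                              (∃[ s ] ¬ s ∈ₛ B) × IsComponent P B
  properComponent⇒component {B} pc =
    (proj₁ (outsider pc) , proj₂ (proj₂ (outsider pc))) ,
    λ i → uniform-component (R P i) B (twoPoints pc) (λ x y z → uniform pc i x y z _)

  restrict-properComponent : {S M : Subset F} → ProperComponentIn P S M →
                             ProperComponentIn (restrict P S) fullₛ ⟨ (λ x → mem M (proj₁ x)) ⟩
  restrict-properComponent {S} {M} pc = record
    { M⊆S = λ _ _ → _
    ; outsider = let (s , s∈S , s∉M) = outsider pc in (s , s∈S) , _ , s∉M
    ; twoPoints = let (a , b , a≢b , a∈M , b∈M) = twoPoints pc in
                  (a , M⊆S pc a a∈M) , (b , M⊆S pc b b∈M) , a≢b ∘ cong proj₁ , a∈M , b∈M
    ; uniform = λ i x y z _ → uniform pc i (proj₁ x) (proj₁ y) (proj₁ z) (proj₂ x) }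

  pair-no-properComponent : {x y : Carrier F} {M : Subset F} → ¬ ProperComponentIn P (pair {F} x y) M
  pair-no-properComponent {x} {y} pc with twoPoints pc | outsider pc
  ... | a , b , a≢b , a∈M , b∈M | s , s∈ , s∉M
    with pair-view F x y a (M⊆S pc a a∈M) | pair-view F x y b (M⊆S pc b b∈M) | pair-view F x y s s∈
  ...   | inj₁ refl | inj₁ refl | _ = a≢b refl
  ...   | inj₂ refl | inj₂ refl | _ = a≢b refl
  ...   | inj₁ refl | inj₂ refl | inj₁ refl = s∉M a∈M
  ...   | inj₁ refl | inj₂ refl | inj₂ refl = s∉M b∈M
  ...   | inj₂ refl | inj₁ refl | inj₁ refl = s∉M b∈M
  ...   | inj₂ refl | inj₁ refl | inj₂ refl = s∉M a∈M

module _ {F : FinSet} {P : Profile F} {S : Subset F} where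

  properComponent-within : ∀ {M} → ProperComponentIn P S M → (S' M' : Subset F) →
                           S' ⊆ₛ S → M' ⊆ₛ M → M' ⊆ₛ S' → (∀ x → x ∈ₛ S' → x ∈ₛ M → x ∈ₛ M') →
                           ∃[ s ] (s ∈ₛ S' × ¬ s ∈ₛ M') → Nontrivial M' → ProperComponentIn P S' M'
  properComponent-within pc S' M' S'⊆S M'⊆M M'⊆S' S'∩M⊆M' out two = record
    { M⊆S = M'⊆S' ; outsider = out ; twoPoints = two
    ; uniform = λ i x y z x∈S' x∉M' y∈M' z∈M' →
        uniform pc i x y z (S'⊆S x x∈S') (x∉M' ∘ S'∩M⊆M' x x∈S') (M'⊆M y y∈M') (M'⊆M z z∈M') }

  module _ {M₁ M₂ : Subset F} (pc₁ : ProperComponentIn P S M₁) (pc₂ : ProperComponentIn P S M₂) where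

    properComponent-∪ : ∀ {c} → c ∈ₛ M₁ → c ∈ₛ M₂ → ∃[ s ] (s ∈ₛ S × ¬ s ∈ₛ (M₁ ∪ M₂)) →
                        ProperComponentIn P S (M₁ ∪ M₂)
    properComponent-∪ {c} c∈M₁ c∈M₂ out = record
      { M⊆S = λ x x∈ → [ M⊆S pc₁ x , M⊆S pc₂ x ]′ (T-∨⁻ x∈)
      ; outsider = out
      ; twoPoints = let (a , b , a≢b , a∈M₁ , b∈M₁) = twoPoints pc₁ in a , b , a≢b , T-∨⁺ˡ a∈M₁ , T-∨⁺ˡ b∈M₁
      ; uniform = λ i x y z x∈S x∉ y∈ z∈ →
          Indiscernible-trans (R P i) (like-c i x y x∈S x∉ y∈)
                                      (Indiscernible-sym (R P i) (like-c i x z x∈S x∉ z∈)) }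
      where
      like-c : ∀ i x y → x ∈ₛ S → ¬ x ∈ₛ (M₁ ∪ M₂) → y ∈ₛ (M₁ ∪ M₂) → Indiscernible (R P i) x y c
      like-c i x y x∈S x∉ y∈ with T-∨⁻ {mem M₁ y} y∈
      ... | inj₁ y∈M₁ = uniform pc₁ i x y c x∈S (x∉ ∘ T-∨⁺ˡ) y∈M₁ c∈M₁
      ... | inj₂ y∈M₂ = uniform pc₂ i x y c x∈S (x∉ ∘ T-∨⁺ʳ {mem M₁ x}) y∈M₂ c∈M₂

    properComponent-∩ : Nontrivial (M₁ ∩ₛ M₂) → ∀ {e} → e ∈ₛ M₁ → ¬ e ∈ₛ M₂ → ProperComponentIn P S (M₁ ∩ₛ M₂)
    properComponent-∩ two {e} e∈M₁ e∉M₂ = record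
      { M⊆S = λ x x∈ → M⊆S pc₁ x (T-∧⁻ˡ x∈)
      ; outsider = e , M⊆S pc₁ e e∈M₁ , e∉M₂ ∘ T-∧⁻ʳ {mem M₁ e}
      ; twoPoints = two
      ; uniform = uniform-∩ }
      where
      uniform-∩ : ∀ i x y z → x ∈ₛ S → ¬ x ∈ₛ (M₁ ∩ₛ M₂) → y ∈ₛ (M₁ ∩ₛ M₂) → z ∈ₛ (M₁ ∩ₛ M₂) →
                  Indiscernible (R P i) x y z
      uniform-∩ i x y z x∈S x∉ y∈ z∈ with T? (mem M₁ x)
      ... | no x∉M₁ = uniform pc₁ i x y z x∈S x∉M₁ (T-∧⁻ˡ y∈) (T-∧⁻ˡ z∈)
      ... | yes x∈M₁ =
        uniform pc₂ i x y z x∈S (x∉ ∘ T-∧⁺ x∈M₁) (T-∧⁻ʳ {mem M₁ y} y∈) (T-∧⁻ʳ {mem M₁ z} z∈)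

    properComponent-∖ : Nontrivial (M₁ ∖ₛ M₂) → ∀ {c} → c ∈ₛ M₁ → c ∈ₛ M₂ → ∀ {e} → e ∈ₛ M₂ → ¬ e ∈ₛ M₁ →
                        ProperComponentIn P S (M₁ ∖ₛ M₂)
    properComponent-∖ two {c} c∈M₁ c∈M₂ {e} e∈M₂ e∉M₁ = record
      { M⊆S = λ x x∈ → M⊆S pc₁ x (T-∧⁻ˡ x∈)
      ; outsider = c , M⊆S pc₁ c c∈M₁ , λ c∈ → T-not⁻ (T-∧⁻ʳ {mem M₁ c} c∈) c∈M₂
      ; twoPoints = two
      ; uniform = uniform-∖ }
      where
      uniform-∖ : ∀ i x y z → x ∈ₛ S → ¬ x ∈ₛ (M₁ ∖ₛ M₂) → y ∈ₛ (M₁ ∖ₛ M₂) → z ∈ₛ (M₁ ∖ₛ M₂) →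
                  Indiscernible (R P i) x y z
      uniform-∖ i x y z x∈S x∉ y∈ z∈ with T? (mem M₁ x) | T? (mem M₂ x)
      ... | no x∉M₁ | _ = uniform pc₁ i x y z x∈S x∉M₁ (T-∧⁻ˡ y∈) (T-∧⁻ˡ z∈)
      ... | yes x∈M₁ | no x∉M₂ = ⊥-elim (x∉ (T-∧⁺ x∈M₁ (T-not⁺ x∉M₂)))
      ... | yes _ | yes x∈M₂ =
        let y∈M₁ = T-∧⁻ˡ y∈ ; z∈M₁ = T-∧⁻ˡ z∈
            y∉M₂ = T-not⁻ (T-∧⁻ʳ {mem M₁ y} y∈) ; z∉M₂ = T-not⁻ (T-∧⁻ʳ {mem M₁ z} z∈)
            (yx≡ye , xy≡ey) = uniform pc₂ i y x e (M⊆S pc₁ y y∈M₁) y∉M₂ x∈M₂ e∈M₂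
            (zx≡ze , xz≡ez) = uniform pc₂ i z x e (M⊆S pc₁ z z∈M₁) z∉M₂ x∈M₂ e∈M₂
            (ey≡ez , ye≡ze) = uniform pc₁ i e y z (M⊆S pc₂ e e∈M₂) e∉M₁ y∈M₁ z∈M₁
        in trans xy≡ey (trans ey≡ez (sym xz≡ez)) , trans yx≡ye (trans ye≡ze (sym zx≡ze))

-- Collapsing a component to a representative

module _ {F : FinSet} where

  collapse : Subset F → Subset F → Carrier F → Subset F
  collapse S M m = ⟨ (λ x → (mem S x ∧ not (mem M x)) ∨ ⌊ _≟_ F x m ⌋) ⟩

  module _ (S M : Subset F) (m : Carrier F) where

    collapse-view : ∀ {x} → x ∈ₛ collapse S M m → (x ∈ₛ S × ¬ x ∈ₛ M) ⊎ x ≡ m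
    collapse-view {x} x∈ with T-∨⁻ {mem S x ∧ not (mem M x)} x∈
    ... | inj₁ t = inj₁ (T-∧⁻ˡ t , T-not⁻ (T-∧⁻ʳ {mem S x} t))
    ... | inj₂ t = inj₂ (toWitness {a? = _≟_ F x m} t)

    collapse-∖ : ∀ {x} → x ∈ₛ S → ¬ x ∈ₛ M → x ∈ₛ collapse S M m
    collapse-∖ {x} x∈S x∉M = T-∨⁺ˡ {mem S x ∧ not (mem M x)} (T-∧⁺ {mem S x} x∈S (T-not⁺ x∉M))

    collapse-rep : m ∈ₛ collapse S M m
    collapse-rep = T-∨⁺ʳ {mem S m ∧ not (mem M m)} (fromWitness {a? = _≟_ F m m} refl)

    collapse-⊆ : M ⊆ₛ S → m ∈ₛ M → collapse S M m ⊆ₛ S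
    collapse-⊆ M⊆S m∈M x x∈ with collapse-view x∈
    ... | inj₁ (x∈S , _) = x∈S
    ... | inj₂ refl = M⊆S m m∈M

  collapse-nested : (S : Subset F) {M₁ M₂ : Subset F} {m : Carrier F} → M₁ ⊆ₛ M₂ → m ∈ₛ M₁ →
                    collapse (collapse S M₁ m) (collapse M₂ M₁ m) m ≐ collapse S M₂ m
  collapse-nested S {M₁} {M₂} {m} M₁⊆M₂ m∈M₁ = ⊆-antisym {S = collapse T₁ M₂' m} into onto
    where
    T₁ = collapse S M₁ m
    M₂' = collapse M₂ M₁ m

    into : collapse T₁ M₂' m ⊆ₛ collapse S M₂ m
    into x x∈ with collapse-view T₁ M₂' m x∈
    ... | inj₂ refl = collapse-rep S M₂ m
    ... | inj₁ (x∈T₁ , x∉M₂') with collapse-view S M₁ m x∈T₁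
    ...   | inj₂ refl = ⊥-elim (x∉M₂' (collapse-rep M₂ M₁ m))
    ...   | inj₁ (x∈S , x∉M₁) = collapse-∖ S M₂ m x∈S (x∉M₂' ∘ λ x∈M₂ → collapse-∖ M₂ M₁ m x∈M₂ x∉M₁)

    onto : collapse S M₂ m ⊆ₛ collapse T₁ M₂' m
    onto x x∈ with collapse-view S M₂ m x∈
    ... | inj₂ refl = collapse-rep T₁ M₂' m
    ... | inj₁ (x∈S , x∉M₂) = collapse-∖ T₁ M₂' m (collapse-∖ S M₁ m x∈S (x∉M₂ ∘ M₁⊆M₂ x)) x∉M₂'
      where
      x∉M₂' : ¬ x ∈ₛ M₂'
      x∉M₂' x∈M₂' with collapse-view M₂ M₁ m x∈M₂'
      ... | inj₁ (x∈M₂ , _) = x∉M₂ x∈M₂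
      ... | inj₂ refl = x∉M₂ (M₁⊆M₂ x m∈M₁)

  collapse-disjoint-⊆ : (S : Subset F) {M₁ M₂ : Subset F} → (∀ x → x ∈ₛ M₁ → ¬ x ∈ₛ M₂) →
                        ∀ {m₁ m₂} → m₁ ∈ₛ M₁ → m₂ ∈ₛ M₂ →
                        collapse (collapse S M₁ m₁) M₂ m₂ ⊆ₛ collapse (collapse S M₂ m₂) M₁ m₁
  collapse-disjoint-⊆ S {M₁} {M₂} M₁∩M₂≡∅ {m₁} {m₂} m₁∈M₁ m₂∈M₂ x x∈
    with collapse-view (collapse S M₁ m₁) M₂ m₂ x∈
  ... | inj₂ refl = collapse-∖ T₂ M₁ m₁ (collapse-rep S M₂ m₂) (λ x∈M₁ → M₁∩M₂≡∅ x x∈M₁ m₂∈M₂)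
    where T₂ = collapse S M₂ m₂
  ... | inj₁ (x∈T₁ , x∉M₂) with collapse-view S M₁ m₁ x∈T₁
  ...   | inj₂ refl = collapse-rep (collapse S M₂ m₂) M₁ m₁
  ...   | inj₁ (x∈S , x∉M₁) = collapse-∖ (collapse S M₂ m₂) M₁ m₁ (collapse-∖ S M₂ m₂ x∈S x∉M₂) x∉M₁

  collapse-cover : (S M₁ M₂ : Subset F) {c : Carrier F} → M₂ ⊆ₛ S → c ∈ₛ M₂ →
                   (∀ x → x ∈ₛ S → ¬ x ∈ₛ M₁ → x ∈ₛ M₂) → (∀ x → x ∈ₛ M₁ → x ∈ₛ M₂ → x ≡ c) →
                   collapse S M₁ c ≐ M₂
  collapse-cover S M₁ M₂ {c} M₂⊆S c∈M₂ S∖M₁⊆M₂ M₁∩M₂⊆c = ⊆-antisym {S = collapse S M₁ c} into onto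
    where
    into : collapse S M₁ c ⊆ₛ M₂
    into x x∈ with collapse-view S M₁ c x∈
    ... | inj₁ (x∈S , x∉M₁) = S∖M₁⊆M₂ x x∈S x∉M₁
    ... | inj₂ refl = c∈M₂

    onto : M₂ ⊆ₛ collapse S M₁ c
    onto x x∈M₂ with T? (mem M₁ x)
    ... | yes x∈M₁ = subst (_∈ₛ collapse S M₁ c) (sym (M₁∩M₂⊆c x x∈M₁ x∈M₂)) (collapse-rep S M₁ c)
    ... | no x∉M₁ = collapse-∖ S M₁ c (M₂⊆S x x∈M₂) x∉M₁

module _ {F : FinSet} {P : Profile F} {S : Subset F} where

  module _ {M : Subset F} (pc : ProperComponentIn P S M) where

    size-component< : size F M < size F S
    size-component< = size-mono-< M S (M⊆S pc) (proj₁ (proj₂ (outsider pc))) (proj₂ (proj₂ (outsider pc)))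

    size-collapse< : ∀ {m} → m ∈ₛ M → size F (collapse S M m) < size F S
    size-collapse< {m} m∈M with another pc m m∈M
    ... | y , y∈M , y≢m = size-mono-< (collapse S M m) S (collapse-⊆ S M m (M⊆S pc) m∈M) (M⊆S pc y y∈M) y∉
      where
      y∉ : ¬ y ∈ₛ collapse S M m
      y∉ y∈ with collapse-view S M m y∈
      ... | inj₁ (_ , y∉M) = y∉M y∈M
      ... | inj₂ y≡m = y≢m y≡m

  collapse-nested-properComponent : ∀ {M₁ M₂ m y} → ProperComponentIn P S M₂ → M₁ ⊆ₛ M₂ → m ∈ₛ M₁ →
                                    y ∈ₛ M₂ → ¬ y ∈ₛ M₁ →
                                    ProperComponentIn P (collapse S M₁ m) (collapse M₂ M₁ m)
  collapse-nested-properComponent {M₁} {M₂} {m} {y} pc₂ M₁⊆M₂ m∈M₁ y∈M₂ y∉M₁ =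
    properComponent-within pc₂ T₁ M₂'
      (collapse-⊆ S M₁ m (λ x → M⊆S pc₂ x ∘ M₁⊆M₂ x) m∈M₁) (collapse-⊆ M₂ M₁ m M₁⊆M₂ m∈M₁) M₂'⊆T₁ T₁∩M₂⊆M₂'
      (s , collapse-∖ S M₁ m s∈S (s∉M₂ ∘ M₁⊆M₂ s) , s∉M₂ ∘ collapse-⊆ M₂ M₁ m M₁⊆M₂ m∈M₁ s)
      (m , y , ∈∉⇒≢ M₁ m∈M₁ y∉M₁ , collapse-rep M₂ M₁ m , collapse-∖ M₂ M₁ m y∈M₂ y∉M₁)
    where
    T₁ = collapse S M₁ m
    M₂' = collapse M₂ M₁ m
    s = proj₁ (outsider pc₂)
    s∈S = proj₁ (proj₂ (outsider pc₂))
    s∉M₂ = proj₂ (proj₂ (outsider pc₂))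

    M₂'⊆T₁ : M₂' ⊆ₛ T₁
    M₂'⊆T₁ x x∈ with collapse-view M₂ M₁ m x∈
    ... | inj₁ (x∈M₂ , x∉M₁) = collapse-∖ S M₁ m (M⊆S pc₂ x x∈M₂) x∉M₁
    ... | inj₂ refl = collapse-rep S M₁ m

    T₁∩M₂⊆M₂' : ∀ x → x ∈ₛ T₁ → x ∈ₛ M₂ → x ∈ₛ M₂'
    T₁∩M₂⊆M₂' x x∈T₁ x∈M₂ with collapse-view S M₁ m x∈T₁
    ... | inj₁ (_ , x∉M₁) = collapse-∖ M₂ M₁ m x∈M₂ x∉M₁
    ... | inj₂ refl = collapse-rep M₂ M₁ m

  collapse-disjoint-properComponent : ∀ {M₁ M₂ m₁} → (∀ x → x ∈ₛ M₁ → ¬ x ∈ₛ M₂) → M₁ ⊆ₛ S →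
                                      ProperComponentIn P S M₂ → m₁ ∈ₛ M₁ →
                                      ProperComponentIn P (collapse S M₁ m₁) M₂
  collapse-disjoint-properComponent {M₁} {M₂} {m₁} M₁∩M₂≡∅ M₁⊆S pc₂ m₁∈M₁ =
    properComponent-within pc₂ (collapse S M₁ m₁) M₂ (collapse-⊆ S M₁ m₁ M₁⊆S m₁∈M₁) (λ _ → id)
      (λ x x∈M₂ → collapse-∖ S M₁ m₁ (M⊆S pc₂ x x∈M₂) (λ x∈M₁ → M₁∩M₂≡∅ x x∈M₁ x∈M₂)) (λ _ _ → id)
      (m₁ , collapse-rep S M₁ m₁ , M₁∩M₂≡∅ m₁ m₁∈M₁) (twoPoints pc₂)

module _ {F : FinSet} where

  -- The right-hand side of (CC), with S/M represented by collapse S M m and m standing for the block M.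
  expand : (Subset F → Subset F) → Subset F → Subset F → Carrier F → Subset F
  expand E S M m = ⟨ (λ x → if mem M x then mem (E (collapse S M m)) m ∧ mem (E M) x
                                       else mem S x ∧ mem (E (collapse S M m)) x) ⟩

  module _ (E : Subset F → Subset F) (S M : Subset F) (m : Carrier F) where

    expand-inside : ∀ {x} → x ∈ₛ M → mem (expand E S M m) x ≡ mem (E (collapse S M m)) m ∧ mem (E M) x
    expand-inside x∈M rewrite T⇒≡true x∈M = refl

    expand-beside : ∀ {x} → x ∈ₛ S → ¬ x ∈ₛ M → mem (expand E S M m) x ≡ mem (E (collapse S M m)) x
    expand-beside x∈S x∉M rewrite ¬T⇒≡false x∉M | T⇒≡true x∈S = refl

    expand-outside : M ⊆ₛ S → ∀ {x} → ¬ x ∈ₛ S → mem (expand E S M m) x ≡ false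
    expand-outside M⊆S {x} x∉S rewrite ¬T⇒≡false (x∉S ∘ M⊆S x) | ¬T⇒≡false x∉S = refl

    expand-⊆ : M ⊆ₛ S → expand E S M m ⊆ₛ S
    expand-⊆ M⊆S x x∈ with T? (mem S x)
    ... | yes x∈S = x∈S
    ... | no x∉S = ⊥-elim (subst T (expand-outside M⊆S x∉S) x∈)

    expand-nonempty : E (collapse S M m) ⊆ₛ collapse S M m → E M ⊆ₛ M →
                      Nonempty (E (collapse S M m)) → Nonempty (E M) → Nonempty (expand E S M m)
    expand-nonempty ET⊆T EM⊆M (x , x∈ET) (y , y∈EM) with collapse-view S M m (ET⊆T x x∈ET)
    ... | inj₁ (x∈S , x∉M) = x , subst T (sym (expand-beside x∈S x∉M)) x∈ET
    ... | inj₂ refl = y , subst T (sym (expand-inside (EM⊆M y y∈EM))) (T-∧⁺ x∈ET y∈EM)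

  expand-cong : (E E' : Subset F → Subset F) (S M : Subset F) (m : Carrier F) →
                E (collapse S M m) ≐ E' (collapse S M m) → E M ≐ E' M → expand E S M m ≐ expand E' S M m
  expand-cong E E' S M m e₁ e₂ x rewrite e₁ x | e₁ m | e₂ x = refl

  expand-ext : (E E' : Subset F → Subset F) (S M M' : Subset F) (m m' : Carrier F) → M ⊆ₛ S → M ≐ M' →
               mem (E (collapse S M m)) m ≡ mem (E' (collapse S M' m')) m' →
               (∀ x → x ∈ₛ S → ¬ x ∈ₛ M → mem (E (collapse S M m)) x ≡ mem (E' (collapse S M' m')) x) →
               (∀ x → x ∈ₛ M → mem (E M) x ≡ mem (E' M') x) →
               expand E S M m ≐ expand E' S M' m'
  expand-ext E E' S M M' m m' M⊆S M≐M' rep≡ beside≡ inside≡ x = at (position S M x)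
    where
    open ≡-Reasoning
    M⊆M' : M ⊆ₛ M'
    M⊆M' = ≐⇒⊆ {S = M} M≐M'
    M'⊆M : M' ⊆ₛ M
    M'⊆M = ≐⇒⊆ {S = M'} (≐-sym {S = M} M≐M')

    at : Position S M x → mem (expand E S M m) x ≡ mem (expand E' S M' m') x
    at (inside x∈M) = begin
      mem (expand E S M m) x                           ≡⟨ expand-inside E S M m x∈M ⟩
      mem (E (collapse S M m)) m ∧ mem (E M) x         ≡⟨ cong₂ _∧_ rep≡ (inside≡ x x∈M) ⟩
      mem (E' (collapse S M' m')) m' ∧ mem (E' M') x   ≡⟨ expand-inside E' S M' m' (M⊆M' x x∈M) ⟨
      mem (expand E' S M' m') x                        ∎
    at (beside x∈S x∉M) = begin
      mem (expand E S M m) x                           ≡⟨ expand-beside E S M m x∈S x∉M ⟩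
      mem (E (collapse S M m)) x                       ≡⟨ beside≡ x x∈S x∉M ⟩
      mem (E' (collapse S M' m')) x                    ≡⟨ expand-beside E' S M' m' x∈S (x∉M ∘ M'⊆M x) ⟨
      mem (expand E' S M' m') x                        ∎
    at (outside x∉S) =
      trans (expand-outside E S M m M⊆S x∉S) (sym (expand-outside E' S M' m' (λ y → M⊆S y ∘ M'⊆M y) x∉S))

  module _ (E : Subset F → Subset F) (S M : Subset F) {x : Carrier F} where

    expand-single-inside : M ⊆ₛ S → x ∈ₛ M → E (collapse S M x) ≐ single x → E M ≐ single x →
                           expand E S M x ≐ single x
    expand-single-inside M⊆S x∈M T≐x M≐x z with position S M z
    ... | inside z∈M rewrite expand-inside E S M x z∈M | T≐x x | ⌊≟⌋-refl F x = M≐x z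
    ... | beside z∈S z∉M = trans (expand-beside E S M x z∈S z∉M) (T≐x z)
    ... | outside z∉S =
      trans (expand-outside E S M x M⊆S z∉S) (sym (⌊≟⌋-≢ F (∈∉⇒≢ S (M⊆S x x∈M) z∉S ∘ sym)))

    expand-single-beside : M ⊆ₛ S → x ∈ₛ S → ¬ x ∈ₛ M → ∀ {m} → m ∈ₛ M → E (collapse S M m) ≐ single x →
                           expand E S M m ≐ single x
    expand-single-beside M⊆S x∈S x∉M {m} m∈M T≐x z with position S M z
    ... | inside z∈M rewrite expand-inside E S M m z∈M | T≐x m | ⌊≟⌋-≢ F (∈∉⇒≢ M m∈M x∉M)
                           | ⌊≟⌋-≢ F (∈∉⇒≢ M z∈M x∉M) = refl
    ... | beside z∈S z∉M = trans (expand-beside E S M m z∈S z∉M) (T≐x z)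
    ... | outside z∉S = trans (expand-outside E S M m M⊆S z∉S) (sym (⌊≟⌋-≢ F (∈∉⇒≢ S x∈S z∉S ∘ sym)))

-- Isomorphisms between restricted profiles

record RestrictedIso {F F* : FinSet} (P : Profile F) (S : Subset F) (P* : Profile F*) (S* : Subset F*) : Set where
  field
    to        : Carrier F → Carrier F*
    from      : Carrier F* → Carrier F
    to∈       : ∀ x → x ∈ₛ S → to x ∈ₛ S*
    from∈     : ∀ y → y ∈ₛ S* → from y ∈ₛ S
    from-to   : ∀ x → x ∈ₛ S → from (to x) ≡ x
    to-from   : ∀ y → y ∈ₛ S* → to (from y) ≡ y
    voters    : Fin (n P) ↔ Fin (n P*)
    preserves : ∀ i x y → x ∈ₛ S → y ∈ₛ S → R P i x y ≡ R P* (Inverse.to voters i) (to x) (to y)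

open RestrictedIso

module _ {F F* : FinSet} {P : Profile F} {P* : Profile F*} {S : Subset F} {S* : Subset F*} where

  RestrictedIso-sym : RestrictedIso P S P* S* → RestrictedIso P* S* P S
  RestrictedIso-sym π = record
    { to = from π ; from = to π ; to∈ = from∈ π ; from∈ = to∈ π ; from-to = to-from π ; to-from = from-to π
    ; voters = ↔-sym (voters π)
    ; preserves = λ j u v u∈ v∈ → sym (begin
        R P (Inverse.from (voters π) j) (from π u) (from π v)
          ≡⟨ preserves π _ (from π u) (from π v) (from∈ π u u∈) (from∈ π v v∈) ⟩
        R P* (Inverse.to (voters π) (Inverse.from (voters π) j)) (to π (from π u)) (to π (from π v))
          ≡⟨ cong₂ (λ k w → R P* k w _) (Inverse.strictlyInverseˡ (voters π) j) (to-from π u u∈) ⟩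
        R P* j u (to π (from π v))
          ≡⟨ cong (R P* j u) (to-from π v v∈) ⟩
        R P* j u v ∎) }
    where open ≡-Reasoning

  RestrictedIso-restrict : (π : RestrictedIso P S P* S*) (U : Subset F) (U* : Subset F*) → U ⊆ₛ S → U* ⊆ₛ S* →
                           (∀ x → x ∈ₛ U → to π x ∈ₛ U*) → (∀ y → y ∈ₛ U* → from π y ∈ₛ U) →
                           RestrictedIso P U P* U*
  RestrictedIso-restrict π U U* U⊆S U*⊆S* to∈U* from∈U = record
    { to = to π ; from = from π ; to∈ = to∈U* ; from∈ = from∈U
    ; from-to = λ x x∈ → from-to π x (U⊆S x x∈) ; to-from = λ y y∈ → to-from π y (U*⊆S* y y∈)
    ; voters = voters π ; preserves = λ i x y x∈ y∈ → preserves π i x y (U⊆S x x∈) (U⊆S y y∈) }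

module _ {F : FinSet} {P : Profile F} where

  ≐⇒RestrictedIso : (S S' : Subset F) → S ≐ S' → RestrictedIso P S P S'
  ≐⇒RestrictedIso S S' S≐S' = record
    { to = id ; from = id ; to∈ = ≐⇒⊆ {S = S} S≐S' ; from∈ = ≐⇒⊆ {S = S'} (≐-sym {S = S} S≐S')
    ; from-to = λ _ _ → refl ; to-from = λ _ _ → refl
    ; voters = ↔-id _ ; preserves = λ _ _ _ _ _ → refl }

  involution⇒RestrictedIso : (S S' : Subset F) (f : Carrier F → Carrier F) → (∀ x → f (f x) ≡ x) →
                             (∀ x → x ∈ₛ S → f x ∈ₛ S') → (∀ y → y ∈ₛ S' → f y ∈ₛ S) →
                             (∀ i x y → x ∈ₛ S → y ∈ₛ S → R P i x y ≡ R P i (f x) (f y)) →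
                             RestrictedIso P S P S'
  involution⇒RestrictedIso S S' f f-inv f∈S' f∈S f-pres = record
    { to = f ; from = f ; to∈ = f∈S' ; from∈ = f∈S ; from-to = λ x _ → f-inv x ; to-from = λ y _ → f-inv y
    ; voters = ↔-id _ ; preserves = f-pres }

  sub-RestrictedIso : (S : Subset F) → Nonempty S → RestrictedIso (restrict P S) fullₛ P S
  sub-RestrictedIso S (s₀ , s₀∈S) = record
    { to = proj₁ ; from = from′ ; to∈ = λ (_ , x∈S) _ → x∈S ; from∈ = λ _ _ → _
    ; from-to = λ (x , x∈S) _ → from-to′ x x∈S ; to-from = λ y y∈S → cong proj₁ (from-to′ y y∈S)
    ; voters = ↔-id _ ; preserves = λ _ _ _ _ _ → refl }
    where
    from′ : Carrier F → Carrier (Sub F S)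
    from′ y with T? (mem S y)
    ... | yes y∈S = y , y∈S
    ... | no _ = s₀ , s₀∈S

    from-to′ : ∀ x (x∈S : x ∈ₛ S) → from′ x ≡ (x , x∈S)
    from-to′ x x∈S with T? (mem S x)
    ... | yes x∈S' = cong (x ,_) (T-irrelevant x∈S' x∈S)
    ... | no x∉S = ⊥-elim (x∉S x∈S)

profileIso⇒RestrictedIso : {F F* : FinSet} {P : Profile F} {P* : Profile F*} (φ : Carrier F ↔ Carrier F*) →
                           IsProfileIso P P* φ → (S : Subset F) → RestrictedIso P S P* (image φ S)
profileIso⇒RestrictedIso φ (ψ , preserves′) S = record
  { to = Inverse.to φ ; from = Inverse.from φ
  ; to∈ = λ x x∈S → subst (_∈ₛ S) (sym (Inverse.strictlyInverseʳ φ x)) x∈S ; from∈ = λ _ y∈ → y∈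
  ; from-to = λ x _ → Inverse.strictlyInverseʳ φ x ; to-from = λ y _ → Inverse.strictlyInverseˡ φ y
  ; voters = ψ ; preserves = λ i x y _ _ → preserves′ x y i }

module Swap (F : FinSet) (a b : Carrier F) where

  swap : Carrier F → Carrier F
  swap x with _≟_ F x a | _≟_ F x b
  ... | yes _ | _     = b
  ... | no _  | yes _ = a
  ... | no _  | no _  = x

  swap-left : swap a ≡ b
  swap-left with _≟_ F a a
  ... | yes _ = refl
  ... | no a≢a = ⊥-elim (a≢a refl)

  swap-right : swap b ≡ a
  swap-right with _≟_ F b a | _≟_ F b b
  ... | yes b≡a | _ = b≡a
  ... | no _ | yes _ = refl
  ... | no _ | no b≢b = ⊥-elim (b≢b refl)

  swap-other : ∀ {x} → ¬ x ≡ a → ¬ x ≡ b → swap x ≡ x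
  swap-other {x} x≢a x≢b with _≟_ F x a | _≟_ F x b
  ... | yes x≡a | _ = ⊥-elim (x≢a x≡a)
  ... | no _ | yes x≡b = ⊥-elim (x≢b x≡b)
  ... | no _ | no _ = refl

  swap-involutive : ∀ x → swap (swap x) ≡ x
  swap-involutive x with _≟_ F x a | _≟_ F x b
  ... | yes refl | _ = swap-right
  ... | no _ | yes refl = swap-left
  ... | no x≢a | no x≢b = swap-other x≢a x≢b

module _ {F : FinSet} {P : Profile F} {S M : Subset F} (pc : ProperComponentIn P S M) {m m' : Carrier F}
         (m∈M : m ∈ₛ M) (m'∈M : m' ∈ₛ M) where

  open Swap F m m'

  swap-outside : ∀ {x} → ¬ x ∈ₛ M → swap x ≡ x
  swap-outside x∉M = swap-other (∈∉⇒≢ M m∈M x∉M ∘ sym) (∈∉⇒≢ M m'∈M x∉M ∘ sym)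

  private
    swap-from-m : ∀ {x} → (x ∈ₛ S × ¬ x ∈ₛ M) ⊎ x ≡ m → swap x ∈ₛ collapse S M m'
    swap-from-m (inj₁ (x∈S , x∉M)) rewrite swap-outside x∉M = collapse-∖ S M m' x∈S x∉M
    swap-from-m (inj₂ refl) rewrite swap-left = collapse-rep S M m'

    swap-from-m' : ∀ {y} → (y ∈ₛ S × ¬ y ∈ₛ M) ⊎ y ≡ m' → swap y ∈ₛ collapse S M m
    swap-from-m' (inj₁ (y∈S , y∉M)) rewrite swap-outside y∉M = collapse-∖ S M m y∈S y∉M
    swap-from-m' (inj₂ refl) rewrite swap-right = collapse-rep S M m

    swap-preserves : ∀ i {x y} → (x ∈ₛ S × ¬ x ∈ₛ M) ⊎ x ≡ m → (y ∈ₛ S × ¬ y ∈ₛ M) ⊎ y ≡ m →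
                     R P i x y ≡ R P i (swap x) (swap y)
    swap-preserves i (inj₁ (_ , x∉M)) (inj₁ (_ , y∉M)) rewrite swap-outside x∉M | swap-outside y∉M = refl
    swap-preserves i (inj₁ (x∈S , x∉M)) (inj₂ refl) rewrite swap-outside x∉M | swap-left =
      proj₁ (uniform pc i _ m m' x∈S x∉M m∈M m'∈M)
    swap-preserves i (inj₂ refl) (inj₁ (y∈S , y∉M)) rewrite swap-outside y∉M | swap-left =
      proj₂ (uniform pc i _ m m' y∈S y∉M m∈M m'∈M)
    swap-preserves i (inj₂ refl) (inj₂ refl) rewrite swap-left =
      trans (T⇒≡true (R-refl P i m)) (sym (T⇒≡true (R-refl P i m')))

  collapse-swap-RestrictedIso : RestrictedIso P (collapse S M m) P (collapse S M m')
  collapse-swap-RestrictedIso =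
    involution⇒RestrictedIso (collapse S M m) (collapse S M m') swap swap-involutive
      (λ x x∈ → swap-from-m (collapse-view S M m x∈))
      (λ y y∈ → swap-from-m' (collapse-view S M m' y∈))
      (λ i x y x∈ y∈ → swap-preserves i (collapse-view S M m x∈) (collapse-view S M m y∈))

module TwoPointIso {F : FinSet} (P : Profile F) {S S' : Subset F} {a c a' c' : Carrier F}
                   (S⊆ac : ∀ x → x ∈ₛ S → x ≡ a ⊎ x ≡ c) (S'⊆a'c' : ∀ x → x ∈ₛ S' → x ≡ a' ⊎ x ≡ c')
                   (a∈S : a ∈ₛ S) (c∈S : c ∈ₛ S) (a'∈S' : a' ∈ₛ S') (c'∈S' : c' ∈ₛ S')
                   (a≢c : ¬ a ≡ c) (a'≢c' : ¬ a' ≡ c')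
                   (ac≡a'c' : ∀ i → R P i a c ≡ R P i a' c') (ca≡c'a' : ∀ i → R P i c a ≡ R P i c' a') where

  private
    to′ : Carrier F → Carrier F
    to′ x = if ⌊ _≟_ F x a ⌋ then a' else c'

    from′ : Carrier F → Carrier F
    from′ y = if ⌊ _≟_ F y a' ⌋ then a else c

  to-a : to′ a ≡ a'
  to-a = cong (if_then a' else c') (⌊≟⌋-refl F a)

  to-c : to′ c ≡ c'
  to-c = cong (if_then a' else c') (⌊≟⌋-≢ F (a≢c ∘ sym))

  private
    from-a' : from′ a' ≡ a
    from-a' = cong (if_then a else c) (⌊≟⌋-refl F a')

    from-c' : from′ c' ≡ c
    from-c' = cong (if_then a else c) (⌊≟⌋-≢ F (a'≢c' ∘ sym))

    to∈′ : ∀ {x} → x ≡ a ⊎ x ≡ c → to′ x ∈ₛ S'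
    to∈′ (inj₁ refl) = subst (_∈ₛ S') (sym to-a) a'∈S'
    to∈′ (inj₂ refl) = subst (_∈ₛ S') (sym to-c) c'∈S'

    from∈′ : ∀ {y} → y ≡ a' ⊎ y ≡ c' → from′ y ∈ₛ S
    from∈′ (inj₁ refl) = subst (_∈ₛ S) (sym from-a') a∈S
    from∈′ (inj₂ refl) = subst (_∈ₛ S) (sym from-c') c∈S

    from-to′ : ∀ {x} → x ≡ a ⊎ x ≡ c → from′ (to′ x) ≡ x
    from-to′ (inj₁ refl) = trans (cong from′ to-a) from-a'
    from-to′ (inj₂ refl) = trans (cong from′ to-c) from-c'

    to-from′ : ∀ {y} → y ≡ a' ⊎ y ≡ c' → to′ (from′ y) ≡ y
    to-from′ (inj₁ refl) = trans (cong to′ from-a') to-a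
    to-from′ (inj₂ refl) = trans (cong to′ from-c') to-c

    refl≡refl : ∀ i x y → R P i x x ≡ R P i y y
    refl≡refl i x y = trans (T⇒≡true (R-refl P i x)) (sym (T⇒≡true (R-refl P i y)))

    preserves′ : ∀ i {x y} → x ≡ a ⊎ x ≡ c → y ≡ a ⊎ y ≡ c → R P i x y ≡ R P i (to′ x) (to′ y)
    preserves′ i (inj₁ refl) (inj₁ refl) rewrite to-a = refl≡refl i a a'
    preserves′ i (inj₁ refl) (inj₂ refl) rewrite to-a | to-c = ac≡a'c' i
    preserves′ i (inj₂ refl) (inj₁ refl) rewrite to-a | to-c = ca≡c'a' i
    preserves′ i (inj₂ refl) (inj₂ refl) rewrite to-c = refl≡refl i c c'

  twoPoint-RestrictedIso : RestrictedIso P S P S'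
  twoPoint-RestrictedIso = record
    { to = to′ ; from = from′
    ; to∈ = λ x x∈ → to∈′ (S⊆ac x x∈) ; from∈ = λ y y∈ → from∈′ (S'⊆a'c' y y∈)
    ; from-to = λ x x∈ → from-to′ (S⊆ac x x∈) ; to-from = λ y y∈ → to-from′ (S'⊆a'c' y y∈)
    ; voters = ↔-id _
    ; preserves = λ i x y x∈ y∈ → preserves′ i (S⊆ac x x∈) (S⊆ac y y∈) }

Σ-≡ : {A : Set} {p : A → Bool} {x x' : A} {t : T (p x)} {t' : T (p x')} → x ≡ x' →
      _≡_ {A = Σ A (λ z → T (p z))} (x , t) (x' , t')
Σ-≡ {x = x} {t = t} {t'} refl = cong (x ,_) (T-irrelevant t t')

module _ {F : FinSet} (S : Subset F) where

  liftSub-inside : (U : Subset (Sub F S)) {x : Carrier F} (x∈S : x ∈ₛ S) → mem (liftSub S U) x ≡ mem U (x , x∈S)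
  liftSub-inside U {x} x∈S with T? (mem S x)
  ... | yes x∈S' rewrite T-irrelevant x∈S x∈S' = refl
  ... | no x∉S = ⊥-elim (x∉S x∈S)

  liftSub-outside : (U : Subset (Sub F S)) {x : Carrier F} → ¬ x ∈ₛ S → mem (liftSub S U) x ≡ false
  liftSub-outside U {x} x∉S with T? (mem S x)
  ... | yes x∈S = ⊥-elim (x∉S x∈S)
  ... | no _ = refl

  liftSub-cong : {U U' : Subset (Sub F S)} → U ≐ U' → liftSub S U ≐ liftSub S U'
  liftSub-cong U≐U' x with T? (mem S x)
  ... | yes x∈S = U≐U' (x , x∈S)
  ... | no _ = refl

module _ {F F* : FinSet} {P : Profile F} {P* : Profile F*} {S : Subset F} {S* : Subset F*} where

  RestrictedIso⇒↔ : RestrictedIso P S P* S* → Carrier (Sub F S) ↔ Carrier (Sub F* S*)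
  RestrictedIso⇒↔ π = mk↔ₛ′ (λ (x , x∈) → to π x , to∈ π x x∈) (λ (y , y∈) → from π y , from∈ π y y∈)
                            (λ (y , y∈) → Σ-≡ (to-from π y y∈)) (λ (x , x∈) → Σ-≡ (from-to π x x∈))

  RestrictedIso⇒IsProfileIso : (π : RestrictedIso P S P* S*) →
                               IsProfileIso (restrict P S) (restrict P* S*) (RestrictedIso⇒↔ π)
  RestrictedIso⇒IsProfileIso π = voters π , λ (x , x∈) (y , y∈) i → preserves π i x y x∈ y∈

invariant-under-RestrictedIso : (C : RuleFun) → Iso C → Indep C →
                                ∀ {F F*} {P : Profile F} {P* : Profile F*} {S S*} (π : RestrictedIso P S P* S*) →
                                ∀ x → x ∈ₛ S → mem (C F P S) x ≡ mem (C F* P* S*) (to π x)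
invariant-under-RestrictedIso C iso indep {F} {F*} {P} {P*} {S} {S*} π x x∈S = begin
  mem (C F P S) x                              ≡⟨ indep F P S (x , x∈S) x ⟩
  mem (liftSub S (Cᵣ F P S)) x                 ≡⟨ liftSub-inside S _ x∈S ⟩
  mem (Cᵣ F P S) (x , x∈S)                     ≡⟨ cong (mem (Cᵣ F P S)) (Σ-≡ (sym (from-to π x x∈S))) ⟩
  mem (Cᵣ F P S) (Inverse.from φ (to π x , y∈S*))
    ≡⟨ iso (Sub F S) (Sub F* S*) (restrict P S) (restrict P* S*) φ (RestrictedIso⇒IsProfileIso π)
           fullₛ ((x , x∈S) , _) (to π x , y∈S*) ⟨
  mem (Cᵣ F* P* S*) (to π x , y∈S*)            ≡⟨ liftSub-inside S* _ y∈S* ⟨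
  mem (liftSub S* (Cᵣ F* P* S*)) (to π x)      ≡⟨ indep F* P* S* (to π x , y∈S*) (to π x) ⟨
  mem (C F* P* S*) (to π x)                    ∎
  where
  open ≡-Reasoning
  Cᵣ : (F : FinSet) (P : Profile F) (S : Subset F) → Subset (Sub F S)
  Cᵣ F P S = C (Sub F S) (restrict P S) fullₛ
  y∈S* = to∈ π x x∈S
  φ = RestrictedIso⇒↔ π

-- Quotients

allB⁻ : {A : Set} (g : A → Bool) {xs : List A} → T (allB g xs) → ∀ {z} → z ∈ xs → T (g z)
allB⁻ g {x ∷ xs} all (here refl) = T-∧⁻ˡ all
allB⁻ g {x ∷ xs} all (there z∈) = allB⁻ g (T-∧⁻ʳ {g x} all) z∈

allB⁺ : {A : Set} (g : A → Bool) (xs : List A) → (∀ z → T (g z)) → T (allB g xs)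
allB⁺ g [] _ = _
allB⁺ g (x ∷ xs) all = T-∧⁺ (all x) (allB⁺ g xs all)

module _ {F : FinSet} (B : Subset F) where

  allIn⁻ : (f : Carrier F → Bool) → T (allIn F B f) → ∀ z → z ∈ₛ B → T (f z)
  allIn⁻ f all z z∈B = [ (λ z∉B → ⊥-elim (T-not⁻ z∉B z∈B)) , id ]′
                         (T-∨⁻ (allB⁻ (λ z → not (mem B z) ∨ f z) all (complete F z)))

  allIn⁺ : (f : Carrier F → Bool) → (∀ z → z ∈ₛ B → T (f z)) → T (allIn F B f)
  allIn⁺ f all = allB⁺ _ (enum F) λ z → case T? (mem B z) of λ where
                                          (yes z∈B) → T-∨⁺ʳ {not (mem B z)} (all z z∈B)
                                          (no z∉B) → T-∨⁺ˡ (T-not⁺ z∉B)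

  unquot-∉ : (U : Subset (Quot F B)) {x : Carrier F} (x∉B : T (not (mem B x))) →
             mem (unquot B U) x ≡ mem U (inj₁ (x , x∉B))
  unquot-∉ U {x} x∉B with T? (not (mem B x))
  ... | yes x∉B' rewrite T-irrelevant x∉B x∉B' = refl
  ... | no ¬x∉B = ⊥-elim (¬x∉B x∉B)

  unquot-∈ : (U : Subset (Quot F B)) {x : Carrier F} → x ∈ₛ B → mem (unquot B U) x ≡ false
  unquot-∈ U {x} x∈B with T? (not (mem B x))
  ... | yes x∉B = ⊥-elim (T-not⁻ x∉B x∈B)
  ... | no _ = refl

  unquot-cong : {U U' : Subset (Quot F B)} → U ≐ U' → unquot B U ≐ unquot B U'
  unquot-cong U≐U' x with T? (not (mem B x))
  ... | yes x∉B = U≐U' (inj₁ (x , x∉B))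
  ... | no _ = refl

  private
    ⋆ᵦ : Carrier (Quot F B)
    ⋆ᵦ = ⋆ {F} {B}

  recombine-at : (U : Subset (Quot F B)) (V : Subset F) (x : Carrier F) →
                 mem (recombine B U V) x ≡ (mem U ⋆ᵦ ∧ mem V x) ∨ mem (unquot B U) x
  recombine-at U V x with mem U ⋆ᵦ
  ... | true = ∨-comm (mem (unquot B U) x) (mem V x)
  ... | false = refl

  recombine-cong : {U U' : Subset (Quot F B)} {V V' : Subset F} → U ≐ U' → V ≐ V' →
                   recombine B U V ≐ recombine B U' V'
  recombine-cong {U} {U'} {V} {V'} U≐U' V≐V' x = begin
    mem (recombine B U V) x                        ≡⟨ recombine-at U V x ⟩
    (mem U ⋆ᵦ ∧ mem V x) ∨ mem (unquot B U) x
      ≡⟨ cong₂ _∨_ (cong₂ _∧_ (U≐U' ⋆ᵦ) (V≐V' x)) (unquot-cong U≐U' x) ⟩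
    (mem U' ⋆ᵦ ∧ mem V' x) ∨ mem (unquot B U') x   ≡⟨ recombine-at U' V' x ⟨
    mem (recombine B U' V') x                      ∎
    where open ≡-Reasoning

module _ {F : FinSet} {P : Profile F} {S B : Subset F} (comp : IsComponent P B)
         {b : Carrier F} (b∈B : b ∈ₛ B) where

  private
    to′ : Carrier (Quot F B) → Carrier F
    to′ (inj₁ (y , _)) = y
    to′ (inj₂ tt) = b

    from′ : Carrier F → Carrier (Quot F B)
    from′ y with T? (not (mem B y))
    ... | yes y∉B = inj₁ (y , y∉B)
    ... | no _ = ⋆ {F} {B}

    from-b : from′ b ≡ ⋆ {F} {B}
    from-b with T? (not (mem B b))
    ... | yes b∉B = ⊥-elim (T-not⁻ b∉B b∈B)
    ... | no _ = refl

    from-∉ : ∀ {y} (y∉B : T (not (mem B y))) → from′ y ≡ inj₁ (y , y∉B)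
    from-∉ {y} y∉B with T? (not (mem B y))
    ... | yes y∉B' rewrite T-irrelevant y∉B y∉B' = refl
    ... | no ¬y∉B = ⊥-elim (¬y∉B y∉B)

    to∈′ : ∀ u → u ∈ₛ quotS S B → to′ u ∈ₛ collapse S B b
    to∈′ (inj₁ (y , y∉B)) y∈S = collapse-∖ S B b y∈S (T-not⁻ y∉B)
    to∈′ (inj₂ tt) _ = collapse-rep S B b

    from∈′ : ∀ {y} → (y ∈ₛ S × ¬ y ∈ₛ B) ⊎ y ≡ b → from′ y ∈ₛ quotS S B
    from∈′ (inj₁ (y∈S , y∉B)) rewrite from-∉ (T-not⁺ y∉B) = y∈S
    from∈′ (inj₂ refl) rewrite from-b = _

    from-to′ : ∀ u → from′ (to′ u) ≡ u
    from-to′ (inj₁ (y , y∉B)) = from-∉ y∉B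
    from-to′ (inj₂ tt) = from-b

    to-from′ : ∀ {y} → (y ∈ₛ S × ¬ y ∈ₛ B) ⊎ y ≡ b → to′ (from′ y) ≡ y
    to-from′ (inj₁ (_ , y∉B)) rewrite from-∉ (T-not⁺ y∉B) = refl
    to-from′ (inj₂ refl) rewrite from-b = refl

    preserves′ : ∀ i u v → R (quotP P B) i u v ≡ R P i (to′ u) (to′ v)
    preserves′ i (inj₁ _) (inj₁ _) = refl
    preserves′ i (inj₂ tt) (inj₂ tt) = sym (T⇒≡true (R-refl P i b))
    preserves′ i (inj₂ tt) (inj₁ (y , y∉B)) =
      T-injective (λ all → allIn⁻ B (λ z → R P i z y) all b b∈B)
                  (λ r → allIn⁺ B (λ z → R P i z y) (proj₂ (proj₂ (comp i) y (T-not⁻ y∉B)) (b , b∈B , r)))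
    preserves′ i (inj₁ (x , x∉B)) (inj₂ tt) =
      T-injective (λ all → allIn⁻ B (λ z → R P i x z) all b b∈B)
                  (λ r → allIn⁺ B (λ z → R P i x z) (proj₁ (proj₂ (comp i) x (T-not⁻ x∉B)) (b , b∈B , r)))

  quotient-RestrictedIso : RestrictedIso (quotP P B) (quotS S B) P (collapse S B b)
  quotient-RestrictedIso = record
    { to = to′ ; from = from′ ; to∈ = to∈′ ; from∈ = λ y y∈ → from∈′ (collapse-view S B b y∈)
    ; from-to = λ u _ → from-to′ u ; to-from = λ y y∈ → to-from′ (collapse-view S B b y∈)
    ; voters = ↔-id _ ; preserves = λ i u v _ _ → preserves′ i u v }

module _ {F F* : FinSet} {P : Profile F} {P* : Profile F*} {S : Subset F} {S* : Subset F*}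
         (π : RestrictedIso P S P* S*) where

  transport : Subset F → Subset F*
  transport M = ⟨ (λ y → mem S* y ∧ mem M (from π y)) ⟩

  transport-to : (M : Subset F) → ∀ x → x ∈ₛ S → mem (transport M) (to π x) ≡ mem M x
  transport-to M x x∈S rewrite T⇒≡true (to∈ π x x∈S) | from-to π x x∈S = refl

  transport-∈ : (M : Subset F) → M ⊆ₛ S → ∀ x → x ∈ₛ M → to π x ∈ₛ transport M
  transport-∈ M M⊆S x x∈M = subst T (sym (transport-to M x (M⊆S x x∈M))) x∈M

  transport-∉ : (M : Subset F) → ∀ x → x ∈ₛ S → ¬ x ∈ₛ M → ¬ to π x ∈ₛ transport M
  transport-∉ M x x∈S x∉M x∈ = x∉M (subst T (transport-to M x x∈S) x∈)

  transport-properComponent : {M : Subset F} → ProperComponentIn P S M → ProperComponentIn P* S* (transport M)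
  transport-properComponent {M} pc = record
    { M⊆S = λ y y∈ → T-∧⁻ˡ y∈
    ; outsider = let (s , s∈S , s∉M) = outsider pc in to π s , to∈ π s s∈S , transport-∉ M s s∈S s∉M
    ; twoPoints = let (a , b , a≢b , a∈M , b∈M) = twoPoints pc in
        to π a , to π b ,
        (λ e → a≢b (begin a ≡⟨ sym (from-to π a (M⊆S pc a a∈M)) ⟩ from π (to π a) ≡⟨ cong (from π) e ⟩
                          from π (to π b) ≡⟨ from-to π b (M⊆S pc b b∈M) ⟩ b ∎)) ,
        transport-∈ M (M⊆S pc) a a∈M , transport-∈ M (M⊆S pc) b b∈M
    ; uniform = uniform* }
    where
    open ≡-Reasoning
    π⁻¹ = RestrictedIso-sym π
    uniform* : ∀ j x y z → x ∈ₛ S* → ¬ x ∈ₛ transport M → y ∈ₛ transport M → z ∈ₛ transport M →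
               Indiscernible (R P* j) x y z
    uniform* j x y z x∈S* x∉ y∈ z∈ =
      let y∈S* = T-∧⁻ˡ {mem S* y} y∈
          z∈S* = T-∧⁻ˡ {mem S* z} z∈
          (xy≡xz , yx≡zx) = uniform pc (Inverse.from (voters π) j) (from π x) (from π y) (from π z)
                              (from∈ π x x∈S*) (x∉ ∘ T-∧⁺ {mem S* x} x∈S*)
                              (T-∧⁻ʳ {mem S* y} y∈) (T-∧⁻ʳ {mem S* z} z∈)
      in trans (preserves π⁻¹ j x y x∈S* y∈S*) (trans xy≡xz (sym (preserves π⁻¹ j x z x∈S* z∈S*))) ,
         trans (preserves π⁻¹ j y x y∈S* x∈S*) (trans yx≡zx (sym (preserves π⁻¹ j z x z∈S* x∈S*)))

-- The rule Cᶜᶜ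

module Construction (C : RuleFun) (rule : IsRule C) where

  step : (F : FinSet) (P : Profile F) (S : Subset F) → (Subset F → Subset F) →
         Dec (∃ (ProperComponentIn P S)) → Subset F
  step F P S E (yes (M , pc)) = expand E S M (rep pc)
  step F P S E (no _) = C F P S

  -- Cᶜᶜ never reaches the zero clause: its fuel exceeds |S| and every recursive call shrinks S.
  fuelled : ℕ → RuleFun
  fuelled zero F P S = C F P S
  fuelled (suc k) F P S = step F P S (fuelled k F P) (∃-properComponent? P S)

  fuelled-rule : ∀ k F P S → Nonempty S → Nonempty (fuelled k F P S) × fuelled k F P S ⊆ₛ S
  fuelled-rule zero F P S ne = rule F P S ne
  fuelled-rule (suc k) F P S ne with ∃-properComponent? P S
  ... | no _ = rule F P S ne
  ... | yes (M , pc) =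
    expand-nonempty (fuelled k F P) S M m (proj₂ ruleT) (proj₂ ruleM) (proj₁ ruleT) (proj₁ ruleM) ,
    expand-⊆ (fuelled k F P) S M m (M⊆S pc)
    where
    m = rep pc
    ruleT = fuelled-rule k F P (collapse S M m) (m , collapse-rep S M m)
    ruleM = fuelled-rule k F P M (m , rep∈M pc)

  fuelled-irrelevant : ∀ k k' F P S → size F S < k → size F S < k' → fuelled k F P S ≐ fuelled k' F P S
  fuelled-irrelevant (suc k) (suc k') F P S S<k S<k' with ∃-properComponent? P S
  ... | no _ = ≐-refl {S = C F P S}
  ... | yes (M , pc) = expand-cong (fuelled k F P) (fuelled k' F P) S M m
      (fuelled-irrelevant k k' F P (collapse S M m) (<-≤-trans T<S (s≤s⁻¹ S<k)) (<-≤-trans T<S (s≤s⁻¹ S<k')))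
      (fuelled-irrelevant k k' F P M (<-≤-trans M<S (s≤s⁻¹ S<k)) (<-≤-trans M<S (s≤s⁻¹ S<k')))
    where
    m = rep pc
    T<S = size-collapse< pc (rep∈M pc)
    M<S = size-component< pc

  -- Opaque because unfolding the fuel during conversion checking is prohibitively slow.
  opaque
    Cᶜᶜ : RuleFun
    Cᶜᶜ F P S = fuelled (suc (size F S)) F P S

    Cᶜᶜ-unfold : ∀ F P S → Cᶜᶜ F P S ≐ step F P S (Cᶜᶜ F P) (∃-properComponent? P S)
    Cᶜᶜ-unfold F P S with ∃-properComponent? P S
    ... | no _ = ≐-refl {S = C F P S}
    ... | yes (M , pc) = expand-cong (fuelled (size F S) F P) (Cᶜᶜ F P) S M m
        (fuelled-irrelevant _ _ F P (collapse S M m) (size-collapse< pc (rep∈M pc)) ≤-refl)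
        (fuelled-irrelevant _ _ F P M (size-component< pc) ≤-refl)
      where
      m : Carrier F
      m = rep pc

    Cᶜᶜ-rule : IsRule Cᶜᶜ
    Cᶜᶜ-rule F P S = fuelled-rule (suc (size F S)) F P S

  Cᶜᶜ-outside : ∀ F P S → Nonempty S → ∀ {x} → ¬ x ∈ₛ S → mem (Cᶜᶜ F P S) x ≡ false
  Cᶜᶜ-outside F P S ne x∉S = ¬T⇒≡false (x∉S ∘ proj₂ (Cᶜᶜ-rule F P S ne) _)

-- Independence of the chosen component

module Coherence (C : RuleFun) (rule : IsRule C) (iso : Iso C) (indep : Indep C) where
  open Construction C rule

  -- The two statements are proved together: each uses the other at smaller sizes.
  record Coherent (k : ℕ) : Set₁ where
    field
      expand-any : ∀ {F P S M} m → size F S < k → ProperComponentIn P S M → m ∈ₛ M →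
                   Cᶜᶜ F P S ≐ expand (Cᶜᶜ F P) S M m
      invariant  : ∀ {F F*} {P : Profile F} {P* : Profile F*} {S S*} → size F S < k → size F* S* < k →
                   (π : RestrictedIso P S P* S*) → ∀ x → x ∈ₛ S → mem (Cᶜᶜ F P S) x ≡ mem (Cᶜᶜ F* P* S*) (to π x)

  coherent-zero : Coherent 0
  coherent-zero = record { expand-any = λ _ () ; invariant = λ () }

  module Step (k : ℕ) (coh : Coherent k) where
    open Coherent coh

    Cᶜᶜ-resp-≐ : ∀ {F} {P : Profile F} (S S' : Subset F) → size F S < k → Nonempty S → S ≐ S' →
                 Cᶜᶜ F P S ≐ Cᶜᶜ F P S'
    Cᶜᶜ-resp-≐ {F} {P} S S' S<k (s , s∈S) S≐S' x = at (T? (mem S x))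
      where
      S'⊆S : S' ⊆ₛ S
      S'⊆S = ≐⇒⊆ {S = S'} (≐-sym {S = S} S≐S')

      at : Dec (x ∈ₛ S) → mem (Cᶜᶜ F P S) x ≡ mem (Cᶜᶜ F P S') x
      at (yes x∈S) = invariant S<k (≤-<-trans (size-mono S' S S'⊆S) S<k) (≐⇒RestrictedIso S S' S≐S') x x∈S
      at (no x∉S) = trans (Cᶜᶜ-outside F P S (s , s∈S) x∉S)
                          (sym (Cᶜᶜ-outside F P S' (s , ≐⇒⊆ {S = S} S≐S' s s∈S) (x∉S ∘ S'⊆S x)))

    module _ {F : FinSet} {P : Profile F} {S M : Subset F} (pc : ProperComponentIn P S M)
             (S≤k : size F S ≤ k) where

      private
        E = Cᶜᶜ F P

      collapse<k : ∀ {m} → m ∈ₛ M → size F (collapse S M m) < k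
      collapse<k m∈M = <-≤-trans (size-collapse< pc m∈M) S≤k

      component<k : size F M < k
      component<k = <-≤-trans (size-component< pc) S≤k

      expand-rep : ∀ {m m'} → m ∈ₛ M → m' ∈ₛ M → expand E S M m ≐ expand E S M m'
      expand-rep {m} {m'} m∈M m'∈M =
        expand-ext E E S M M m m' (M⊆S pc) (≐-refl {S = M})
          (trans (swap-invariant m (collapse-rep S M m)) (cong (mem (E T')) swap-left))
          (λ x x∈S x∉M → trans (swap-invariant x (collapse-∖ S M m x∈S x∉M))
                                (cong (mem (E T')) (swap-outside pc m∈M m'∈M x∉M)))
          (λ _ _ → refl)
        where
        open Swap F m m'
        T' = collapse S M m'
        swap-invariant = invariant (collapse<k m∈M) (collapse<k m'∈M) (collapse-swap-RestrictedIso pc m∈M m'∈M)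

      expand-resp-≐ : ∀ {M' m} → M ≐ M' → m ∈ₛ M → expand E S M m ≐ expand E S M' m
      expand-resp-≐ {M'} {m} M≐M' m∈M =
        expand-ext E E S M M' m m (M⊆S pc) M≐M' (T≐T' m) (λ x _ _ → T≐T' x)
          (λ x _ → Cᶜᶜ-resp-≐ M M' component<k (m , m∈M) M≐M' x)
        where
        T≐T' : E (collapse S M m) ≐ E (collapse S M' m)
        T≐T' = Cᶜᶜ-resp-≐ (collapse S M m) (collapse S M' m) (collapse<k m∈M) (m , collapse-rep S M m)
                 (λ x → cong (λ b → (mem S x ∧ not b) ∨ ⌊ _≟_ F x m ⌋) (M≐M' x))

    module _ {F : FinSet} {P : Profile F} {S : Subset F} (S≤k : size F S ≤ k) where

      private
        E : Subset F → Subset F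
        E = Cᶜᶜ F P

        ⟦_⟧ : Subset F → Carrier F → Bool
        ⟦ X ⟧ = mem (Cᶜᶜ F P X)

      module Nested {M₁ M₂ : Subset F} (pc₁ : ProperComponentIn P S M₁) (pc₂ : ProperComponentIn P S M₂)
                    (M₁⊆M₂ : M₁ ⊆ₛ M₂) {y : Carrier F} (y∈M₂ : y ∈ₛ M₂) (y∉M₁ : ¬ y ∈ₛ M₁)
                    {m : Carrier F} (m∈M₁ : m ∈ₛ M₁) where

        open ≡-Reasoning

        T₁ = collapse S M₁ m
        T₂ = collapse S M₂ m
        M₂' = collapse M₂ M₁ m

        M₂'-component : ProperComponentIn P T₁ M₂'
        M₂'-component = collapse-nested-properComponent pc₂ M₁⊆M₂ m∈M₁ y∈M₂ y∉M₁

        M₁-component : ProperComponentIn P M₂ M₁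
        M₁-component = properComponent-within pc₁ M₂ M₁ (M⊆S pc₂) (λ _ → id) M₁⊆M₂ (λ _ _ → id)
                         (y , y∈M₂ , y∉M₁) (twoPoints pc₁)

        T₁-expand : E T₁ ≐ expand E T₁ M₂' m
        T₁-expand = expand-any m (collapse<k pc₁ S≤k m∈M₁) M₂'-component (collapse-rep M₂ M₁ m)

        M₂-expand : E M₂ ≐ expand E M₂ M₁ m
        M₂-expand = expand-any m (component<k pc₂ S≤k) M₁-component m∈M₁

        T₁₂≐T₂ : E (collapse T₁ M₂' m) ≐ E T₂
        T₁₂≐T₂ = Cᶜᶜ-resp-≐ (collapse T₁ M₂' m) T₂
                   (<-trans (size-collapse< M₂'-component (collapse-rep M₂ M₁ m)) (collapse<k pc₁ S≤k m∈M₁))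
                   (m , collapse-rep T₁ M₂' m) (collapse-nested S M₁⊆M₂ m∈M₁)

        expand-nested : expand E S M₁ m ≐ expand E S M₂ m
        expand-nested x with position S M₂ x
        ... | inside x∈M₂ with T? (mem M₁ x)
        ...   | yes x∈M₁ = begin
          mem (expand E S M₁ m) x                            ≡⟨ expand-inside E S M₁ m x∈M₁ ⟩
          ⟦ T₁ ⟧ m ∧ ⟦ M₁ ⟧ x                                ≡⟨ cong (_∧ ⟦ M₁ ⟧ x) (T₁-expand m) ⟩
          mem (expand E T₁ M₂' m) m ∧ ⟦ M₁ ⟧ x
            ≡⟨ cong (_∧ ⟦ M₁ ⟧ x) (expand-inside E T₁ M₂' m (collapse-rep M₂ M₁ m)) ⟩
          (⟦ collapse T₁ M₂' m ⟧ m ∧ ⟦ M₂' ⟧ m) ∧ ⟦ M₁ ⟧ x  ≡⟨ cong (λ b → (b ∧ ⟦ M₂' ⟧ m) ∧ ⟦ M₁ ⟧ x) (T₁₂≐T₂ m) ⟩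
          (⟦ T₂ ⟧ m ∧ ⟦ M₂' ⟧ m) ∧ ⟦ M₁ ⟧ x                  ≡⟨ ∧-assoc (⟦ T₂ ⟧ m) _ _ ⟩
          ⟦ T₂ ⟧ m ∧ (⟦ M₂' ⟧ m ∧ ⟦ M₁ ⟧ x)                  ≡⟨ cong (⟦ T₂ ⟧ m ∧_) (expand-inside E M₂ M₁ m x∈M₁) ⟨
          ⟦ T₂ ⟧ m ∧ mem (expand E M₂ M₁ m) x                ≡⟨ cong (⟦ T₂ ⟧ m ∧_) (M₂-expand x) ⟨
          ⟦ T₂ ⟧ m ∧ ⟦ M₂ ⟧ x                                ≡⟨ expand-inside E S M₂ m x∈M₂ ⟨
          mem (expand E S M₂ m) x                            ∎
        ...   | no x∉M₁ = begin
          mem (expand E S M₁ m) x                  ≡⟨ expand-beside E S M₁ m (M⊆S pc₂ x x∈M₂) x∉M₁ ⟩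
          ⟦ T₁ ⟧ x                                 ≡⟨ T₁-expand x ⟩
          mem (expand E T₁ M₂' m) x                ≡⟨ expand-inside E T₁ M₂' m (collapse-∖ M₂ M₁ m x∈M₂ x∉M₁) ⟩
          ⟦ collapse T₁ M₂' m ⟧ m ∧ ⟦ M₂' ⟧ x      ≡⟨ cong (_∧ ⟦ M₂' ⟧ x) (T₁₂≐T₂ m) ⟩
          ⟦ T₂ ⟧ m ∧ ⟦ M₂' ⟧ x                     ≡⟨ cong (⟦ T₂ ⟧ m ∧_) (expand-beside E M₂ M₁ m x∈M₂ x∉M₁) ⟨
          ⟦ T₂ ⟧ m ∧ mem (expand E M₂ M₁ m) x      ≡⟨ cong (⟦ T₂ ⟧ m ∧_) (M₂-expand x) ⟨
          ⟦ T₂ ⟧ m ∧ ⟦ M₂ ⟧ x                      ≡⟨ expand-inside E S M₂ m x∈M₂ ⟨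
          mem (expand E S M₂ m) x                  ∎
        expand-nested x | beside x∈S x∉M₂ = begin
          mem (expand E S M₁ m) x                  ≡⟨ expand-beside E S M₁ m x∈S x∉M₁ ⟩
          ⟦ T₁ ⟧ x                                 ≡⟨ T₁-expand x ⟩
          mem (expand E T₁ M₂' m) x                ≡⟨ expand-beside E T₁ M₂' m (collapse-∖ S M₁ m x∈S x∉M₁) x∉M₂' ⟩
          ⟦ collapse T₁ M₂' m ⟧ x                  ≡⟨ T₁₂≐T₂ x ⟩
          ⟦ T₂ ⟧ x                                 ≡⟨ expand-beside E S M₂ m x∈S x∉M₂ ⟨
          mem (expand E S M₂ m) x                  ∎
          where
          x∉M₁ = x∉M₂ ∘ M₁⊆M₂ x
          x∉M₂' = x∉M₂ ∘ collapse-⊆ M₂ M₁ m M₁⊆M₂ m∈M₁ x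
        expand-nested x | outside x∉S =
          trans (expand-outside E S M₁ m (M⊆S pc₁) x∉S) (sym (expand-outside E S M₂ m (M⊆S pc₂) x∉S))

      module Disjoint {M₁ M₂ : Subset F} (pc₁ : ProperComponentIn P S M₁) (pc₂ : ProperComponentIn P S M₂)
                      (M₁∩M₂≡∅ : ∀ x → x ∈ₛ M₁ → ¬ x ∈ₛ M₂)
                      {m₁ m₂ : Carrier F} (m₁∈M₁ : m₁ ∈ₛ M₁) (m₂∈M₂ : m₂ ∈ₛ M₂) where

        open ≡-Reasoning

        M₂∩M₁≡∅ : ∀ x → x ∈ₛ M₂ → ¬ x ∈ₛ M₁
        M₂∩M₁≡∅ x x∈M₂ x∈M₁ = M₁∩M₂≡∅ x x∈M₁ x∈M₂

        T₁ = collapse S M₁ m₁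
        T₂ = collapse S M₂ m₂
        T₁₂ = collapse T₁ M₂ m₂
        T₂₁ = collapse T₂ M₁ m₁

        M₂-component : ProperComponentIn P T₁ M₂
        M₂-component = collapse-disjoint-properComponent M₁∩M₂≡∅ (M⊆S pc₁) pc₂ m₁∈M₁

        T₁-expand : E T₁ ≐ expand E T₁ M₂ m₂
        T₁-expand = expand-any m₂ (collapse<k pc₁ S≤k m₁∈M₁) M₂-component m₂∈M₂

        T₂-expand : E T₂ ≐ expand E T₂ M₁ m₁
        T₂-expand = expand-any m₁ (collapse<k pc₂ S≤k m₂∈M₂)
                      (collapse-disjoint-properComponent M₂∩M₁≡∅ (M⊆S pc₂) pc₁ m₂∈M₂) m₁∈M₁

        T₁₂≐T₂₁ : E T₁₂ ≐ E T₂₁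
        T₁₂≐T₂₁ = Cᶜᶜ-resp-≐ T₁₂ T₂₁ (<-trans (size-collapse< M₂-component m₂∈M₂) (collapse<k pc₁ S≤k m₁∈M₁))
                    (m₂ , collapse-rep T₁ M₂ m₂)
                    (⊆-antisym {S = T₁₂} (collapse-disjoint-⊆ S M₁∩M₂≡∅ m₁∈M₁ m₂∈M₂)
                                         (collapse-disjoint-⊆ S M₂∩M₁≡∅ m₂∈M₂ m₁∈M₁))

        expand-disjoint : expand E S M₁ m₁ ≐ expand E S M₂ m₂
        expand-disjoint x with position S M₁ x
        ... | inside x∈M₁ = begin
          mem (expand E S M₁ m₁) x               ≡⟨ expand-inside E S M₁ m₁ x∈M₁ ⟩
          ⟦ T₁ ⟧ m₁ ∧ ⟦ M₁ ⟧ x                   ≡⟨ cong (_∧ ⟦ M₁ ⟧ x) (T₁-expand m₁) ⟩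
          mem (expand E T₁ M₂ m₂) m₁ ∧ ⟦ M₁ ⟧ x
            ≡⟨ cong (_∧ ⟦ M₁ ⟧ x) (expand-beside E T₁ M₂ m₂ (collapse-rep S M₁ m₁) (M₁∩M₂≡∅ m₁ m₁∈M₁)) ⟩
          ⟦ T₁₂ ⟧ m₁ ∧ ⟦ M₁ ⟧ x                  ≡⟨ cong (_∧ ⟦ M₁ ⟧ x) (T₁₂≐T₂₁ m₁) ⟩
          ⟦ T₂₁ ⟧ m₁ ∧ ⟦ M₁ ⟧ x                  ≡⟨ expand-inside E T₂ M₁ m₁ x∈M₁ ⟨
          mem (expand E T₂ M₁ m₁) x              ≡⟨ T₂-expand x ⟨
          ⟦ T₂ ⟧ x                               ≡⟨ expand-beside E S M₂ m₂ (M⊆S pc₁ x x∈M₁) (M₁∩M₂≡∅ x x∈M₁) ⟨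
          mem (expand E S M₂ m₂) x               ∎
        ... | beside x∈S x∉M₁ with T? (mem M₂ x)
        ...   | yes x∈M₂ = begin
          mem (expand E S M₁ m₁) x               ≡⟨ expand-beside E S M₁ m₁ x∈S x∉M₁ ⟩
          ⟦ T₁ ⟧ x                               ≡⟨ T₁-expand x ⟩
          mem (expand E T₁ M₂ m₂) x              ≡⟨ expand-inside E T₁ M₂ m₂ x∈M₂ ⟩
          ⟦ T₁₂ ⟧ m₂ ∧ ⟦ M₂ ⟧ x                  ≡⟨ cong (_∧ ⟦ M₂ ⟧ x) (T₁₂≐T₂₁ m₂) ⟩
          ⟦ T₂₁ ⟧ m₂ ∧ ⟦ M₂ ⟧ x
            ≡⟨ cong (_∧ ⟦ M₂ ⟧ x) (expand-beside E T₂ M₁ m₁ (collapse-rep S M₂ m₂) (M₂∩M₁≡∅ m₂ m₂∈M₂)) ⟨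
          mem (expand E T₂ M₁ m₁) m₂ ∧ ⟦ M₂ ⟧ x  ≡⟨ cong (_∧ ⟦ M₂ ⟧ x) (T₂-expand m₂) ⟨
          ⟦ T₂ ⟧ m₂ ∧ ⟦ M₂ ⟧ x                   ≡⟨ expand-inside E S M₂ m₂ x∈M₂ ⟨
          mem (expand E S M₂ m₂) x               ∎
        ...   | no x∉M₂ = begin
          mem (expand E S M₁ m₁) x               ≡⟨ expand-beside E S M₁ m₁ x∈S x∉M₁ ⟩
          ⟦ T₁ ⟧ x                               ≡⟨ T₁-expand x ⟩
          mem (expand E T₁ M₂ m₂) x              ≡⟨ expand-beside E T₁ M₂ m₂ (collapse-∖ S M₁ m₁ x∈S x∉M₁) x∉M₂ ⟩
          ⟦ T₁₂ ⟧ x                              ≡⟨ T₁₂≐T₂₁ x ⟩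
          ⟦ T₂₁ ⟧ x                              ≡⟨ expand-beside E T₂ M₁ m₁ (collapse-∖ S M₂ m₂ x∈S x∉M₂) x∉M₁ ⟨
          mem (expand E T₂ M₁ m₁) x              ≡⟨ T₂-expand x ⟨
          ⟦ T₂ ⟧ x                               ≡⟨ expand-beside E S M₂ m₂ x∈S x∉M₂ ⟨
          mem (expand E S M₂ m₂) x               ∎
        expand-disjoint x | outside x∉S =
          trans (expand-outside E S M₁ m₁ (M⊆S pc₁) x∉S) (sym (expand-outside E S M₂ m₂ (M⊆S pc₂) x∉S))

      -- S = {a, c, b} with M₁ = {a, c} and M₂ = {c, b}: the overlap that leaves no smaller component.
      module Triangle {M₁ M₂ : Subset F} (pc₁ : ProperComponentIn P S M₁) (pc₂ : ProperComponentIn P S M₂)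
                      {a b c : Carrier F} (a∈M₁ : a ∈ₛ M₁) (a∉M₂ : ¬ a ∈ₛ M₂) (b∈M₂ : b ∈ₛ M₂) (b∉M₁ : ¬ b ∈ₛ M₁)
                      (c∈M₁ : c ∈ₛ M₁) (c∈M₂ : c ∈ₛ M₂)
                      (S∖M₁⊆M₂ : ∀ x → x ∈ₛ S → ¬ x ∈ₛ M₁ → x ∈ₛ M₂)
                      (M₁∖M₂⊆a : ∀ x → x ∈ₛ M₁ → ¬ x ∈ₛ M₂ → x ≡ a)
                      (M₂∖M₁⊆b : ∀ x → x ∈ₛ M₂ → ¬ x ∈ₛ M₁ → x ≡ b)
                      (M₁∩M₂⊆c : ∀ x → x ∈ₛ M₁ → x ∈ₛ M₂ → x ≡ c) where

        open ≡-Reasoning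

        S∖M₂⊆M₁ : ∀ x → x ∈ₛ S → ¬ x ∈ₛ M₂ → x ∈ₛ M₁
        S∖M₂⊆M₁ x x∈S x∉M₂ with T? (mem M₁ x)
        ... | yes x∈M₁ = x∈M₁
        ... | no x∉M₁ = ⊥-elim (x∉M₂ (S∖M₁⊆M₂ x x∈S x∉M₁))

        T₁≐M₂ : E (collapse S M₁ c) ≐ E M₂
        T₁≐M₂ = Cᶜᶜ-resp-≐ (collapse S M₁ c) M₂ (collapse<k pc₁ S≤k c∈M₁) (c , collapse-rep S M₁ c)
                  (collapse-cover S M₁ M₂ (M⊆S pc₂) c∈M₂ S∖M₁⊆M₂ M₁∩M₂⊆c)

        T₂≐M₁ : E (collapse S M₂ c) ≐ E M₁
        T₂≐M₁ = Cᶜᶜ-resp-≐ (collapse S M₂ c) M₁ (collapse<k pc₂ S≤k c∈M₂) (c , collapse-rep S M₂ c)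
                  (collapse-cover S M₂ M₁ (M⊆S pc₁) c∈M₁ S∖M₂⊆M₁ (λ x x∈M₂ x∈M₁ → M₁∩M₂⊆c x x∈M₁ x∈M₂))

        M₁⊆ac : ∀ x → x ∈ₛ M₁ → x ≡ a ⊎ x ≡ c
        M₁⊆ac x x∈M₁ with T? (mem M₂ x)
        ... | yes x∈M₂ = inj₂ (M₁∩M₂⊆c x x∈M₁ x∈M₂)
        ... | no x∉M₂ = inj₁ (M₁∖M₂⊆a x x∈M₁ x∉M₂)

        M₂⊆cb : ∀ x → x ∈ₛ M₂ → x ≡ c ⊎ x ≡ b
        M₂⊆cb x x∈M₂ with T? (mem M₁ x)
        ... | yes x∈M₁ = inj₁ (M₁∩M₂⊆c x x∈M₁ x∈M₂)
        ... | no x∉M₁ = inj₂ (M₂∖M₁⊆b x x∈M₂ x∉M₁)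

        -- a ↦ c, c ↦ b: R a c = R a b = R c b by uniformity of M₂ seen from a and of M₁ seen from b.
        module π = TwoPointIso P M₁⊆ac M₂⊆cb a∈M₁ c∈M₁ c∈M₂ b∈M₂ (∈∉⇒≢ M₂ c∈M₂ a∉M₂ ∘ sym) (∈∉⇒≢ M₁ c∈M₁ b∉M₁)
          (λ i → trans (proj₁ (uniform pc₂ i a c b (M⊆S pc₁ a a∈M₁) a∉M₂ c∈M₂ b∈M₂))
                       (proj₂ (uniform pc₁ i b a c (M⊆S pc₂ b b∈M₂) b∉M₁ a∈M₁ c∈M₁)))
          (λ i → trans (proj₂ (uniform pc₂ i a c b (M⊆S pc₁ a a∈M₁) a∉M₂ c∈M₂ b∈M₂))
                       (proj₁ (uniform pc₁ i b a c (M⊆S pc₂ b b∈M₂) b∉M₁ a∈M₁ c∈M₁)))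

        M₁<k = component<k pc₁ S≤k
        M₂<k = component<k pc₂ S≤k

        ⟦M₁⟧a≡⟦M₂⟧c : ⟦ M₁ ⟧ a ≡ ⟦ M₂ ⟧ c
        ⟦M₁⟧a≡⟦M₂⟧c = trans (invariant M₁<k M₂<k π.twoPoint-RestrictedIso a a∈M₁) (cong ⟦ M₂ ⟧ π.to-a)

        ⟦M₁⟧c≡⟦M₂⟧b : ⟦ M₁ ⟧ c ≡ ⟦ M₂ ⟧ b
        ⟦M₁⟧c≡⟦M₂⟧b = trans (invariant M₁<k M₂<k π.twoPoint-RestrictedIso c c∈M₁) (cong ⟦ M₂ ⟧ π.to-c)

        expand-triangle : expand E S M₁ c ≐ expand E S M₂ c
        expand-triangle x with position S M₁ x
        ... | inside x∈M₁ with M₁⊆ac x x∈M₁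
        ...   | inj₁ refl = begin
          mem (expand E S M₁ c) a           ≡⟨ expand-inside E S M₁ c a∈M₁ ⟩
          ⟦ collapse S M₁ c ⟧ c ∧ ⟦ M₁ ⟧ a  ≡⟨ cong₂ _∧_ (T₁≐M₂ c) ⟦M₁⟧a≡⟦M₂⟧c ⟩
          ⟦ M₂ ⟧ c ∧ ⟦ M₂ ⟧ c               ≡⟨ ∧-idem (⟦ M₂ ⟧ c) ⟩
          ⟦ M₂ ⟧ c                          ≡⟨ trans (T₂≐M₁ a) ⟦M₁⟧a≡⟦M₂⟧c ⟨
          ⟦ collapse S M₂ c ⟧ a             ≡⟨ expand-beside E S M₂ c (M⊆S pc₁ a a∈M₁) a∉M₂ ⟨
          mem (expand E S M₂ c) a           ∎
        ...   | inj₂ refl = begin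
          mem (expand E S M₁ c) c           ≡⟨ expand-inside E S M₁ c c∈M₁ ⟩
          ⟦ collapse S M₁ c ⟧ c ∧ ⟦ M₁ ⟧ c  ≡⟨ cong (_∧ ⟦ M₁ ⟧ c) (T₁≐M₂ c) ⟩
          ⟦ M₂ ⟧ c ∧ ⟦ M₁ ⟧ c               ≡⟨ ∧-comm (⟦ M₂ ⟧ c) _ ⟩
          ⟦ M₁ ⟧ c ∧ ⟦ M₂ ⟧ c               ≡⟨ cong (_∧ ⟦ M₂ ⟧ c) (T₂≐M₁ c) ⟨
          ⟦ collapse S M₂ c ⟧ c ∧ ⟦ M₂ ⟧ c  ≡⟨ expand-inside E S M₂ c c∈M₂ ⟨
          mem (expand E S M₂ c) c           ∎
        expand-triangle x | beside x∈S x∉M₁ with M₂∖M₁⊆b x (S∖M₁⊆M₂ x x∈S x∉M₁) x∉M₁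
        ... | refl = begin
          mem (expand E S M₁ c) b           ≡⟨ expand-beside E S M₁ c x∈S b∉M₁ ⟩
          ⟦ collapse S M₁ c ⟧ b             ≡⟨ T₁≐M₂ b ⟩
          ⟦ M₂ ⟧ b                          ≡⟨ ∧-idem (⟦ M₂ ⟧ b) ⟨
          ⟦ M₂ ⟧ b ∧ ⟦ M₂ ⟧ b               ≡⟨ cong (_∧ ⟦ M₂ ⟧ b) (trans (T₂≐M₁ c) ⟦M₁⟧c≡⟦M₂⟧b) ⟨
          ⟦ collapse S M₂ c ⟧ c ∧ ⟦ M₂ ⟧ b  ≡⟨ expand-inside E S M₂ c b∈M₂ ⟨
          mem (expand E S M₂ c) b           ∎
        expand-triangle x | outside x∉S =
          trans (expand-outside E S M₁ c (M⊆S pc₁) x∉S) (sym (expand-outside E S M₂ c (M⊆S pc₂) x∉S))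

      expand-⊂ : ∀ {M₁ M₂} → ProperComponentIn P S M₁ → ProperComponentIn P S M₂ → M₁ ⊆ₛ M₂ →
                 ∀ {y} → y ∈ₛ M₂ → ¬ y ∈ₛ M₁ → ∀ {m₁ m₂} → m₁ ∈ₛ M₁ → m₂ ∈ₛ M₂ →
                 expand E S M₁ m₁ ≐ expand E S M₂ m₂
      expand-⊂ pc₁ pc₂ M₁⊆M₂ y∈M₂ y∉M₁ {m₁} m₁∈M₁ m₂∈M₂ =
        ≐-trans {S = expand E S _ m₁} (Nested.expand-nested pc₁ pc₂ M₁⊆M₂ y∈M₂ y∉M₁ m₁∈M₁)
                                      (expand-rep pc₂ S≤k (M₁⊆M₂ _ m₁∈M₁) m₂∈M₂)

      expand-overlap-∖ : ∀ {M₁ M₂} → ProperComponentIn P S M₁ → ProperComponentIn P S M₂ → Nontrivial (M₁ ∖ₛ M₂) →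
                         ∀ {c} → c ∈ₛ M₁ → c ∈ₛ M₂ → ∀ {e} → e ∈ₛ M₂ → ¬ e ∈ₛ M₁ →
                         expand E S M₁ c ≐ expand E S M₂ c
      expand-overlap-∖ {M₁} {M₂} pc₁ pc₂ two {c} c∈M₁ c∈M₂ e∈M₂ e∉M₁ =
        ≐-trans {S = expand E S M₁ c} (expand-rep pc₁ S≤k c∈M₁ (T-∧⁻ˡ u∈A))
          (≐-trans {S = expand E S M₁ u}
            (≐-sym {S = expand E S A u} (Nested.expand-nested pcA pc₁ (λ _ → T-∧⁻ˡ) c∈M₁ c∉A u∈A))
            (Disjoint.expand-disjoint pcA pc₂ (λ x x∈A → T-not⁻ (T-∧⁻ʳ {mem M₁ x} x∈A)) u∈A c∈M₂))
        where
        A = M₁ ∖ₛ M₂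
        pcA = properComponent-∖ pc₁ pc₂ two c∈M₁ c∈M₂ e∈M₂ e∉M₁
        u = proj₁ two
        u∈A : u ∈ₛ A
        u∈A = proj₁ (proj₂ (proj₂ (proj₂ two)))
        c∉A : ¬ c ∈ₛ A
        c∉A c∈A = T-not⁻ (T-∧⁻ʳ {mem M₁ c} c∈A) c∈M₂

      -- Either M₁ ∪ M₂ misses a point of S, or M₁ ∩ M₂, M₁ ∖ M₂ or M₂ ∖ M₁ has two points, or |S| = 3.
      expand-overlap : ∀ {M₁ M₂} → ProperComponentIn P S M₁ → ProperComponentIn P S M₂ →
                       ∀ {c} → c ∈ₛ M₁ → c ∈ₛ M₂ →
                       ∀ {e₁} → e₁ ∈ₛ M₁ → ¬ e₁ ∈ₛ M₂ → ∀ {e₂} → e₂ ∈ₛ M₂ → ¬ e₂ ∈ₛ M₁ →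
                       expand E S M₁ c ≐ expand E S M₂ c
      expand-overlap {M₁} {M₂} pc₁ pc₂ {c} c∈M₁ c∈M₂ {e₁} e₁∈M₁ e₁∉M₂ {e₂} e₂∈M₂ e₂∉M₁ with ⊆-or-∖ S (M₁ ∪ M₂)
      ... | inj₂ out =
        ≐-trans {S = expand E S M₁ c}
          (expand-⊂ pc₁ pcU (λ _ → T-∨⁺ˡ) (T-∨⁺ʳ {mem M₁ e₂} e₂∈M₂) e₂∉M₁ c∈M₁ (T-∨⁺ˡ c∈M₁))
          (≐-sym {S = expand E S M₂ c}
            (expand-⊂ pc₂ pcU (λ x → T-∨⁺ʳ {mem M₁ x}) (T-∨⁺ˡ e₁∈M₁) e₁∉M₂ c∈M₂ (T-∨⁺ˡ c∈M₁)))
        where pcU = properComponent-∪ pc₁ pc₂ c∈M₁ c∈M₂ out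
      ... | inj₁ S⊆M₁∪M₂ with nontrivial? (M₁ ∩ₛ M₂)
      ...   | yes two =
        ≐-trans {S = expand E S M₁ c}
          (≐-sym {S = expand E S I c} (expand-⊂ pcI pc₁ (λ _ → T-∧⁻ˡ) e₁∈M₁ (e₁∉M₂ ∘ T-∧⁻ʳ) c∈I c∈M₁))
          (expand-⊂ pcI pc₂ (λ x → T-∧⁻ʳ {mem M₁ x}) e₂∈M₂ (e₂∉M₁ ∘ T-∧⁻ˡ) c∈I c∈M₂)
        where
        I = M₁ ∩ₛ M₂
        pcI = properComponent-∩ pc₁ pc₂ two e₁∈M₁ e₁∉M₂
        c∈I : c ∈ₛ I
        c∈I = T-∧⁺ c∈M₁ c∈M₂
      ...   | no trivial with nontrivial? (M₁ ∖ₛ M₂) | nontrivial? (M₂ ∖ₛ M₁)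
      ...     | yes two₁ | _ = expand-overlap-∖ pc₁ pc₂ two₁ c∈M₁ c∈M₂ e₂∈M₂ e₂∉M₁
      ...     | no _ | yes two₂ =
        ≐-sym {S = expand E S M₂ c} (expand-overlap-∖ pc₂ pc₁ two₂ c∈M₂ c∈M₁ e₁∈M₁ e₁∉M₂)
      ...     | no trivial₁ | no trivial₂ =
        Triangle.expand-triangle pc₁ pc₂ e₁∈M₁ e₁∉M₂ e₂∈M₂ e₂∉M₁ c∈M₁ c∈M₂
          (λ x x∈S x∉M₁ → [ ⊥-elim ∘ x∉M₁ , id ]′ (T-∨⁻ (S⊆M₁∪M₂ x x∈S)))
          (λ x x∈M₁ x∉M₂ → trivial⇒≡ (M₁ ∖ₛ M₂) trivial₁ (T-∧⁺ e₁∈M₁ (T-not⁺ e₁∉M₂)) x (T-∧⁺ x∈M₁ (T-not⁺ x∉M₂)))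
          (λ x x∈M₂ x∉M₁ → trivial⇒≡ (M₂ ∖ₛ M₁) trivial₂ (T-∧⁺ e₂∈M₂ (T-not⁺ e₂∉M₁)) x (T-∧⁺ x∈M₂ (T-not⁺ x∉M₁)))
          (λ x x∈M₁ x∈M₂ → trivial⇒≡ (M₁ ∩ₛ M₂) trivial (T-∧⁺ c∈M₁ c∈M₂) x (T-∧⁺ x∈M₁ x∈M₂))

      expand-agree : ∀ {M₁ M₂} → ProperComponentIn P S M₁ → ProperComponentIn P S M₂ →
                     ∀ {m₁ m₂} → m₁ ∈ₛ M₁ → m₂ ∈ₛ M₂ → expand E S M₁ m₁ ≐ expand E S M₂ m₂
      expand-agree {M₁} {M₂} pc₁ pc₂ {m₁} {m₂} m₁∈M₁ m₂∈M₂ with ⊆-or-∖ M₁ M₂ | ⊆-or-∖ M₂ M₁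
      ... | inj₁ M₁⊆M₂ | inj₁ M₂⊆M₁ =
        ≐-trans {S = expand E S M₁ m₁} (expand-rep pc₁ S≤k m₁∈M₁ (M₂⊆M₁ m₂ m₂∈M₂))
                (expand-resp-≐ pc₁ S≤k (⊆-antisym {S = M₁} M₁⊆M₂ M₂⊆M₁) (M₂⊆M₁ m₂ m₂∈M₂))
      ... | inj₁ M₁⊆M₂ | inj₂ (y , y∈M₂ , y∉M₁) = expand-⊂ pc₁ pc₂ M₁⊆M₂ y∈M₂ y∉M₁ m₁∈M₁ m₂∈M₂
      ... | inj₂ (y , y∈M₁ , y∉M₂) | inj₁ M₂⊆M₁ =
        ≐-sym {S = expand E S M₂ m₂} (expand-⊂ pc₂ pc₁ M₂⊆M₁ y∈M₁ y∉M₂ m₂∈M₂ m₁∈M₁)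
      ... | inj₂ (e₁ , e₁∈M₁ , e₁∉M₂) | inj₂ (e₂ , e₂∈M₂ , e₂∉M₁) with disjoint-or-∩ M₁ M₂
      ...   | inj₁ M₁∩M₂≡∅ = Disjoint.expand-disjoint pc₁ pc₂ M₁∩M₂≡∅ m₁∈M₁ m₂∈M₂
      ...   | inj₂ (c , c∈M₁ , c∈M₂) =
        ≐-trans {S = expand E S M₁ m₁} (expand-rep pc₁ S≤k m₁∈M₁ c∈M₁)
          (≐-trans {S = expand E S M₁ c} (expand-overlap pc₁ pc₂ c∈M₁ c∈M₂ e₁∈M₁ e₁∉M₂ e₂∈M₂ e₂∉M₁)
                                         (expand-rep pc₂ S≤k c∈M₂ m₂∈M₂))

    expand-any-step : ∀ {F P S M} m → size F S ≤ k → ProperComponentIn P S M → m ∈ₛ M →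
                      Cᶜᶜ F P S ≐ expand (Cᶜᶜ F P) S M m
    expand-any-step {F} {P} {S} {M} m S≤k pc m∈M =
      ≐-trans {S = Cᶜᶜ F P S} (Cᶜᶜ-unfold F P S) (chosen (∃-properComponent? P S))
      where
      chosen : (d : Dec (∃ (ProperComponentIn P S))) → step F P S (Cᶜᶜ F P) d ≐ expand (Cᶜᶜ F P) S M m
      chosen (yes (M₀ , pc₀)) = expand-agree S≤k pc₀ pc (rep∈M pc₀) m∈M
      chosen (no none) = ⊥-elim (none (M , pc))

    module _ {F F* : FinSet} {P : Profile F} {P* : Profile F*} {S : Subset F} {S* : Subset F*}
             (S≤k : size F S ≤ k) (S*≤k : size F* S* ≤ k) (π : RestrictedIso P S P* S*) where

      private
        E : Subset F → Subset F
        E = Cᶜᶜ F P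

        E* : Subset F* → Subset F*
        E* = Cᶜᶜ F* P*

      expand-transport : ∀ {M} (pc : ProperComponentIn P S M) → ∀ {m} → m ∈ₛ M → ∀ x → x ∈ₛ S →
                         mem (expand E S M m) x ≡ mem (expand E* S* (transport π M) (to π m)) (to π x)
      expand-transport {M} pc {m} m∈M x x∈S = at (T? (mem M x))
        where
        open ≡-Reasoning
        M* = transport π M
        pc* = transport-properComponent π pc
        m*∈M* = transport-∈ π M (M⊆S pc) m m∈M
        Tₘ = collapse S M m
        Tₘ* = collapse S* M* (to π m)

        to∈Tₘ* : ∀ x → x ∈ₛ Tₘ → to π x ∈ₛ Tₘ*
        to∈Tₘ* x x∈Tₘ with collapse-view S M m x∈Tₘ
        ... | inj₁ (x∈S , x∉M) = collapse-∖ S* M* (to π m) (to∈ π x x∈S) (transport-∉ π M x x∈S x∉M)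
        ... | inj₂ refl = collapse-rep S* M* (to π m)

        from∈Tₘ : ∀ y → y ∈ₛ Tₘ* → from π y ∈ₛ Tₘ
        from∈Tₘ y y∈Tₘ* with collapse-view S* M* (to π m) y∈Tₘ*
        ... | inj₁ (y∈S* , y∉M*) = collapse-∖ S M m (from∈ π y y∈S*) (y∉M* ∘ T-∧⁺ y∈S*)
        ... | inj₂ refl = subst (_∈ₛ Tₘ) (sym (from-to π m (M⊆S pc m m∈M))) (collapse-rep S M m)

        Tₘ-invariant : ∀ y → y ∈ₛ Tₘ → mem (E Tₘ) y ≡ mem (E* Tₘ*) (to π y)
        Tₘ-invariant = invariant (collapse<k pc S≤k m∈M) (collapse<k pc* S*≤k m*∈M*)
          (RestrictedIso-restrict π Tₘ Tₘ* (collapse-⊆ S M m (M⊆S pc) m∈M)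
                                           (collapse-⊆ S* M* (to π m) (M⊆S pc*) m*∈M*) to∈Tₘ* from∈Tₘ)

        M-invariant : ∀ y → y ∈ₛ M → mem (E M) y ≡ mem (E* M*) (to π y)
        M-invariant = invariant (component<k pc S≤k) (component<k pc* S*≤k)
          (RestrictedIso-restrict π M M* (M⊆S pc) (M⊆S pc*) (transport-∈ π M (M⊆S pc)) (λ y → T-∧⁻ʳ {mem S* y}))

        at : Dec (x ∈ₛ M) → mem (expand E S M m) x ≡ mem (expand E* S* M* (to π m)) (to π x)
        at (yes x∈M) = begin
          mem (expand E S M m) x                        ≡⟨ expand-inside E S M m x∈M ⟩
          mem (E Tₘ) m ∧ mem (E M) x                    ≡⟨ cong₂ _∧_ (Tₘ-invariant m (collapse-rep S M m))
                                                                     (M-invariant x x∈M) ⟩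
          mem (E* Tₘ*) (to π m) ∧ mem (E* M*) (to π x)  ≡⟨ expand-inside E* S* M* (to π m)
                                                             (transport-∈ π M (M⊆S pc) x x∈M) ⟨
          mem (expand E* S* M* (to π m)) (to π x)       ∎
        at (no x∉M) = begin
          mem (expand E S M m) x                        ≡⟨ expand-beside E S M m x∈S x∉M ⟩
          mem (E Tₘ) x                                  ≡⟨ Tₘ-invariant x (collapse-∖ S M m x∈S x∉M) ⟩
          mem (E* Tₘ*) (to π x)                         ≡⟨ expand-beside E* S* M* (to π m) (to∈ π x x∈S)
                                                             (transport-∉ π M x x∈S x∉M) ⟨
          mem (expand E* S* M* (to π m)) (to π x)       ∎

      invariant-step : ∀ x → x ∈ₛ S → mem (Cᶜᶜ F P S) x ≡ mem (Cᶜᶜ F* P* S*) (to π x)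
      invariant-step x x∈S = trans (Cᶜᶜ-unfold F P S x) (at (∃-properComponent? P S))
        where
        at : (d : Dec (∃ (ProperComponentIn P S))) → mem (step F P S E d) x ≡ mem (E* S*) (to π x)
        at (yes (M , pc)) =
          trans (expand-transport pc (rep∈M pc) x x∈S)
                (sym (expand-any-step (to π (rep pc)) S*≤k (transport-properComponent π pc)
                        (transport-∈ π M (M⊆S pc) (rep pc) (rep∈M pc)) (to π x)))
        at (no none) = trans (invariant-under-RestrictedIso C iso indep π x x∈S)
                             (sym (trans (Cᶜᶜ-unfold F* P* S* (to π x)) (at* (∃-properComponent? P* S*))))
          where
          at* : (d : Dec (∃ (ProperComponentIn P* S*))) →
                mem (step F* P* S* E* d) (to π x) ≡ mem (C F* P* S*) (to π x)
          at* (yes (M* , pc*)) = ⊥-elim (none (_ , transport-properComponent (RestrictedIso-sym π) pc*))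
          at* (no _) = refl

    coherent-step : Coherent (suc k)
    coherent-step = record
      { expand-any = λ m S<1+k → expand-any-step m (s≤s⁻¹ S<1+k)
      ; invariant = λ S<1+k S*<1+k π → invariant-step (s≤s⁻¹ S<1+k) (s≤s⁻¹ S*<1+k) π }

  coherent : ∀ k → Coherent k
  coherent zero = coherent-zero
  coherent (suc k) = Step.coherent-step k (coherent k)

-- The axioms for Cᶜᶜ

module Properties (C : RuleFun) (rule : IsRule C) (iso : Iso C) (indep : Indep C) where
  open Construction C rule public
  open Coherence C rule iso indep

  Cᶜᶜ-expand : ∀ {F P S M} m → ProperComponentIn P S M → m ∈ₛ M → Cᶜᶜ F P S ≐ expand (Cᶜᶜ F P) S M m
  Cᶜᶜ-expand {F} {S = S} m = Coherent.expand-any (coherent (suc (size F S))) m ≤-refl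

  Cᶜᶜ-invariant : ∀ {F F*} {P : Profile F} {P* : Profile F*} {S S*} (π : RestrictedIso P S P* S*) →
                  ∀ x → x ∈ₛ S → mem (Cᶜᶜ F P S) x ≡ mem (Cᶜᶜ F* P* S*) (to π x)
  Cᶜᶜ-invariant {F} {F*} {S = S} {S*} =
    Coherent.invariant (coherent (suc (size F S + size F* S*))) (s≤s (m≤m+n _ _)) (s≤s (m≤n+m _ _))

  Cᶜᶜ-resp-≐ : ∀ {F} {P : Profile F} (S S' : Subset F) → Nonempty S → S ≐ S' → Cᶜᶜ F P S ≐ Cᶜᶜ F P S'
  Cᶜᶜ-resp-≐ {F} S S' = Step.Cᶜᶜ-resp-≐ (suc (size F S)) (coherent _) S S' ≤-refl

  Cᶜᶜ-no-component : ∀ {F P S} → ¬ ∃ (ProperComponentIn P S) → Cᶜᶜ F P S ≐ C F P S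
  Cᶜᶜ-no-component {F} {P} {S} none = ≐-trans {S = Cᶜᶜ F P S} (Cᶜᶜ-unfold F P S) (at (∃-properComponent? P S))
    where
    at : (d : Dec (∃ (ProperComponentIn P S))) → step F P S (Cᶜᶜ F P) d ≐ C F P S
    at (yes found) = ⊥-elim (none found)
    at (no _) = ≐-refl {S = C F P S}

  Cᶜᶜ-pair : ∀ {F P} (x y : Carrier F) → Cᶜᶜ F P (pair x y) ≐ C F P (pair x y)
  Cᶜᶜ-pair x y = Cᶜᶜ-no-component (λ (_ , pc) → pair-no-properComponent pc)

  Cᶜᶜ-RecBase : RecBase C Cᶜᶜ
  Cᶜᶜ-RecBase F P S ne none =
    Cᶜᶜ-no-component (λ (_ , pc) → none (_ , properComponent⇒component (restrict-properComponent pc)))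

  Cᶜᶜ-Indep : Indep Cᶜᶜ
  Cᶜᶜ-Indep F P S ne x = at (T? (mem S x))
    where
    at : Dec (x ∈ₛ S) → mem (Cᶜᶜ F P S) x ≡ mem (liftSub S (Cᶜᶜ (Sub F S) (restrict P S) fullₛ)) x
    at (yes x∈S) = trans (sym (Cᶜᶜ-invariant (sub-RestrictedIso S ne) (x , x∈S) _)) (sym (liftSub-inside S _ x∈S))
    at (no x∉S) = trans (Cᶜᶜ-outside F P S ne x∉S) (sym (liftSub-outside S _ x∉S))

  Cᶜᶜ-Iso : Iso Cᶜᶜ
  Cᶜᶜ-Iso F F* P P* φ isoφ S (s , s∈S) y with T? (mem S (Inverse.from φ y))
  ... | yes x∈S = sym (trans (Cᶜᶜ-invariant (profileIso⇒RestrictedIso φ isoφ S) (Inverse.from φ y) x∈S)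
                             (cong (mem (Cᶜᶜ F* P* (image φ S))) (Inverse.strictlyInverseˡ φ y)))
  ... | no x∉S = trans (Cᶜᶜ-outside F* P* (image φ S) (Inverse.to φ s , s∈φS) x∉S)
                       (sym (Cᶜᶜ-outside F P S (s , s∈S) x∉S))
    where s∈φS = subst (_∈ₛ S) (sym (Inverse.strictlyInverseʳ φ s)) s∈S

  module _ {F : FinSet} {P : Profile F} {S B : Subset F} (B⊆S : B ⊆ₛ S) (comp : IsComponent P B) where

    private
      U : Subset (Quot F B)
      U = Cᶜᶜ (Quot F B) (quotP P B) (quotS S B)

      V : Subset F
      V = Cᶜᶜ F P B

      ⋆ᵦ : Carrier (Quot F B)
      ⋆ᵦ = ⋆ {F} {B}

      b : Carrier F
      b = proj₁ (proj₁ (comp (someVoter P)))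

      b∈B : b ∈ₛ B
      b∈B = proj₁ (proj₂ (proj₂ (proj₂ (proj₁ (comp (someVoter P))))))

      U-outside : ∀ {x} (x∉B : T (not (mem B x))) → ¬ x ∈ₛ S → mem U (inj₁ (x , x∉B)) ≡ false
      U-outside x∉B x∉S = Cᶜᶜ-outside _ _ (quotS S B) (⋆ᵦ , _) x∉S

    Cᶜᶜ-CompCons-proper : ∀ {s} → s ∈ₛ S → ¬ s ∈ₛ B → Cᶜᶜ F P S ≐ recombine B U V
    Cᶜᶜ-CompCons-proper {s} s∈S s∉B x =
      trans (Cᶜᶜ-expand b pc b∈B x) (trans (at (position S B x)) (sym (recombine-at B U V x)))
      where
      open ≡-Reasoning
      pc = component⇒properComponent B⊆S (s , s∈S , s∉B) comp
      π = quotient-RestrictedIso comp b∈B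

      at : Position S B x → mem (expand (Cᶜᶜ F P) S B b) x ≡ (mem U ⋆ᵦ ∧ mem V x) ∨ mem (unquot B U) x
      at (inside x∈B) = begin
        mem (expand (Cᶜᶜ F P) S B b) x              ≡⟨ expand-inside (Cᶜᶜ F P) S B b x∈B ⟩
        mem (Cᶜᶜ F P (collapse S B b)) b ∧ mem V x  ≡⟨ cong (_∧ mem V x) (Cᶜᶜ-invariant π ⋆ᵦ _) ⟨
        mem U ⋆ᵦ ∧ mem V x                          ≡⟨ ∨-identityʳ _ ⟨
        (mem U ⋆ᵦ ∧ mem V x) ∨ false                ≡⟨ cong ((mem U ⋆ᵦ ∧ mem V x) ∨_) (unquot-∈ B U x∈B) ⟨
        (mem U ⋆ᵦ ∧ mem V x) ∨ mem (unquot B U) x   ∎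
      at (beside x∈S x∉B) = begin
        mem (expand (Cᶜᶜ F P) S B b) x              ≡⟨ expand-beside (Cᶜᶜ F P) S B b x∈S x∉B ⟩
        mem (Cᶜᶜ F P (collapse S B b)) x            ≡⟨ Cᶜᶜ-invariant π (inj₁ (x , T-not⁺ x∉B)) x∈S ⟨
        mem U (inj₁ (x , T-not⁺ x∉B))               ≡⟨ unquot-∉ B U (T-not⁺ x∉B) ⟨
        mem (unquot B U) x                          ≡⟨ cong (_∨ mem (unquot B U) x) (∧-zeroʳ (mem U ⋆ᵦ)) ⟨
        (mem U ⋆ᵦ ∧ false) ∨ mem (unquot B U) x     ≡⟨ cong (λ v → (mem U ⋆ᵦ ∧ v) ∨ mem (unquot B U) x)
                                                          (Cᶜᶜ-outside F P B (b , b∈B) x∉B) ⟨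
        (mem U ⋆ᵦ ∧ mem V x) ∨ mem (unquot B U) x   ∎
      at (outside x∉S) = begin
        mem (expand (Cᶜᶜ F P) S B b) x              ≡⟨ expand-outside (Cᶜᶜ F P) S B b B⊆S x∉S ⟩
        false                                       ≡⟨ ∧-zeroʳ (mem U ⋆ᵦ) ⟨
        mem U ⋆ᵦ ∧ false                            ≡⟨ ∨-identityʳ _ ⟨
        (mem U ⋆ᵦ ∧ false) ∨ false                  ≡⟨ cong₂ (λ v u → (mem U ⋆ᵦ ∧ v) ∨ u)
                                                             (Cᶜᶜ-outside F P B (b , b∈B) (x∉S ∘ B⊆S x))
                                                             (trans (unquot-∉ B U x∉B) (U-outside x∉B x∉S)) ⟨
        (mem U ⋆ᵦ ∧ mem V x) ∨ mem (unquot B U) x   ∎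
        where x∉B = T-not⁺ (x∉S ∘ B⊆S x)

    Cᶜᶜ-CompCons-covered : Nonempty S → S ⊆ₛ B → Cᶜᶜ F P S ≐ recombine B U V
    Cᶜᶜ-CompCons-covered ne S⊆B x = begin
      mem (Cᶜᶜ F P S) x                          ≡⟨ Cᶜᶜ-resp-≐ S B ne (⊆-antisym {S = S} S⊆B B⊆S) x ⟩
      mem V x                                    ≡⟨ ∨-identityʳ _ ⟨
      mem V x ∨ false                            ≡⟨ cong₂ _∨_ (cong (_∧ mem V x) U⋆≡true) (unquot≡false x) ⟨
      (mem U ⋆ᵦ ∧ mem V x) ∨ mem (unquot B U) x  ≡⟨ recombine-at B U V x ⟨
      mem (recombine B U V) x                    ∎
      where
      open ≡-Reasoning

      U⋆≡true : mem U ⋆ᵦ ≡ true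
      U⋆≡true with Cᶜᶜ-rule (Quot F B) (quotP P B) (quotS S B) (⋆ᵦ , _)
      ... | (inj₂ tt , ⋆∈U) , _ = T⇒≡true ⋆∈U
      ... | (inj₁ (y , y∉B) , y∈U) , U⊆ = ⊥-elim (T-not⁻ y∉B (S⊆B y (U⊆ _ y∈U)))

      unquot≡false : ∀ x → mem (unquot B U) x ≡ false
      unquot≡false x with T? (mem B x)
      ... | yes x∈B = unquot-∈ B U x∈B
      ... | no x∉B = trans (unquot-∉ B U (T-not⁺ x∉B)) (U-outside (T-not⁺ x∉B) (x∉B ∘ S⊆B x))

  Cᶜᶜ-CompCons : CompCons Cᶜᶜ
  Cᶜᶜ-CompCons F P S B ne B⊆S comp with ⊆-or-∖ S B
  ... | inj₁ S⊆B = Cᶜᶜ-CompCons-covered B⊆S comp ne S⊆B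
  ... | inj₂ (s , s∈S , s∉B) = Cᶜᶜ-CompCons-proper B⊆S comp s∈S s∉B

  Cᶜᶜ-RecStep : RecStep Cᶜᶜ
  Cᶜᶜ-RecStep F P S ne B (_ , comp) =
    ≐-trans {S = Cᶜᶜ F P S} (Cᶜᶜ-Indep F P S ne)
      (liftSub-cong S (≐-trans {S = Cᶜᶜ G Q fullₛ}
        (Cᶜᶜ-CompCons G Q fullₛ B (b , _) (λ _ _ → _) comp)
        (recombine-cong B (Cᶜᶜ-resp-≐ (quotS fullₛ B) fullₛ (⋆ {G} {B} , _) quotS-full)
                          (≐-refl {S = Cᶜᶜ G Q B}))))
    where
    G = Sub F S
    Q = restrict P S
    b = proj₁ (proj₁ (comp (someVoter Q)))
    quotS-full : quotS fullₛ B ≐ fullₛ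
    quotS-full (inj₁ _) = refl
    quotS-full (inj₂ tt) = refl

  Cᶜᶜ-unique : ∀ (C′ : RuleFun) → RecBase C C′ → RecStep C′ →
               ∀ F P (S : Subset F) → Nonempty S → C′ F P S ≐ Cᶜᶜ F P S
  Cᶜᶜ-unique C′ base recStep F P S = go F P S (<-wellFounded (size F S))
    where
    go : ∀ F P S → Acc _<_ (size F S) → Nonempty S → C′ F P S ≐ Cᶜᶜ F P S
    go F P S (acc smaller) ne with ∃-properComponent? (restrict P S) fullₛ
    ... | no none =
      ≐-trans {S = C′ F P S} (base F P S ne no-component)
                             (≐-sym {S = Cᶜᶜ F P S} (Cᶜᶜ-RecBase F P S ne no-component))
      where
      no-component : ¬ ∃ (ProperComponentOf P S)
      no-component (B , (s , s∉B) , comp) = none (B , component⇒properComponent (λ _ _ → _) (s , _ , s∉B) comp)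
    ... | yes (B , pc) =
      ≐-trans {S = C′ F P S} (recStep F P S ne B component)
        (≐-trans {S = liftSub S (recombine B (C′ (Quot G B) (quotP Q B) fullₛ) (C′ G Q B))}
          (liftSub-cong S (recombine-cong B (go (Quot G B) (quotP Q B) fullₛ (smaller Quot<S) (⋆ {G} {B} , _))
                                            (go G Q B (smaller B<S) (rep pc , rep∈M pc))))
          (≐-sym {S = Cᶜᶜ F P S} (Cᶜᶜ-RecStep F P S ne B component)))
      where
      G = Sub F S
      Q = restrict P S
      component = properComponent⇒component pc
      B<S : size G B < size F S
      B<S = subst (size G B <_) (size-Sub-full F S) (size-component< pc)
      Quot<S : size (Quot G B) fullₛ < size F S
      Quot<S = subst₂ _<_ (sym (size-Quot-full G B)) (size-Sub-full F S) (size-∁ B (twoPoints pc))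

  Cᶜᶜ-GenCondorcet : GenCondorcet C → GenCondorcet Cᶜᶜ
  Cᶜᶜ-GenCondorcet gc F P S x x∈S wins = go S (<-wellFounded (size F S)) x∈S wins
    where
    go : ∀ S → Acc _<_ (size F S) → x ∈ₛ S → (∀ y → y ∈ₛ S → x ∈ₛ Cᶜᶜ F P (pair x y)) → x ∈ₛ Cᶜᶜ F P S
    go S (acc smaller) x∈S wins with ∃-properComponent? P S
    ... | no none = subst T (sym (Cᶜᶜ-no-component none x))
                      (gc F P S x x∈S (λ y y∈S → subst T (Cᶜᶜ-pair x y x) (wins y y∈S)))
    ... | yes (M , pc) with T? (mem M x)
    ...   | yes x∈M = subst T (sym (trans (Cᶜᶜ-expand x pc x∈M x) (expand-inside (Cᶜᶜ F P) S M x x∈M)))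
                        (T-∧⁺ (go (collapse S M x) (smaller (size-collapse< pc x∈M)) (collapse-rep S M x)
                                 (λ y → wins y ∘ collapse-⊆ S M x (M⊆S pc) x∈M y))
                              (go M (smaller (size-component< pc)) x∈M (λ y → wins y ∘ M⊆S pc y)))
    ...   | no x∉M = subst T (sym (trans (Cᶜᶜ-expand m pc (rep∈M pc) x) (expand-beside (Cᶜᶜ F P) S M m x∈S x∉M)))
                       (go (collapse S M m) (smaller (size-collapse< pc (rep∈M pc))) (collapse-∖ S M m x∈S x∉M)
                           (λ y → wins y ∘ collapse-⊆ S M m (M⊆S pc) (rep∈M pc) y))
      where m = rep pc

  Cᶜᶜ-Condorcet : Condorcet C → Condorcet Cᶜᶜ
  Cᶜᶜ-Condorcet cc F P S x x∈S beats = go S (<-wellFounded (size F S)) x∈S beats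
    where
    go : ∀ S → Acc _<_ (size F S) → x ∈ₛ S → (∀ y → y ∈ₛ S → Cᶜᶜ F P (pair x y) ≐ single x) →
         Cᶜᶜ F P S ≐ single x
    go S (acc smaller) x∈S beats with ∃-properComponent? P S
    ... | no none =
      ≐-trans {S = Cᶜᶜ F P S} (Cᶜᶜ-no-component none)
        (cc F P S x x∈S (λ y y∈S → ≐-trans {S = C F P (pair x y)} (≐-sym {S = Cᶜᶜ F P (pair x y)} (Cᶜᶜ-pair x y))
                                                                    (beats y y∈S)))
    ... | yes (M , pc) with T? (mem M x)
    ...   | yes x∈M =
      ≐-trans {S = Cᶜᶜ F P S} (Cᶜᶜ-expand x pc x∈M)
        (expand-single-inside (Cᶜᶜ F P) S M (M⊆S pc) x∈M
          (go (collapse S M x) (smaller (size-collapse< pc x∈M)) (collapse-rep S M x)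
              (λ y → beats y ∘ collapse-⊆ S M x (M⊆S pc) x∈M y))
          (go M (smaller (size-component< pc)) x∈M (λ y → beats y ∘ M⊆S pc y)))
    ...   | no x∉M =
      ≐-trans {S = Cᶜᶜ F P S} (Cᶜᶜ-expand m pc (rep∈M pc))
        (expand-single-beside (Cᶜᶜ F P) S M (M⊆S pc) x∈S x∉M (rep∈M pc)
          (go (collapse S M m) (smaller (size-collapse< pc (rep∈M pc))) (collapse-∖ S M m x∈S x∉M)
              (λ y → beats y ∘ collapse-⊆ S M m (M⊆S pc) (rep∈M pc) y)))
      where m = rep pc

theorem5 : (C : RuleFun) → IsRule C → Iso C → Indep C → GenCondorcet C → Condorcet C →
    Σ[ C' ∈ RuleFun ]
      ( IsRule C'
      × RecBase C C'
      × RecStep C'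
      × (∀ (C'' : RuleFun) → RecBase C C'' → RecStep C'' →
           ∀ F P (S : Subset F) → Nonempty S → C'' F P S ≐ C' F P S)
      × (∀ F P (S : Subset F) → Nonempty S →
           ¬ (∃[ B ] ProperComponentOf P S B) → C' F P S ≐ C F P S)
      × Iso C' × Indep C' × GenCondorcet C' × Condorcet C' × CompCons C' )
theorem5 C rule iso indep gc cc =
  Cᶜᶜ , Cᶜᶜ-rule , Cᶜᶜ-RecBase , Cᶜᶜ-RecStep , Cᶜᶜ-unique , Cᶜᶜ-RecBase ,
  Cᶜᶜ-Iso , Cᶜᶜ-Indep , Cᶜᶜ-GenCondorcet gc , Cᶜᶜ-Condorcet cc , Cᶜᶜ-CompCons
  where open Properties C rule iso indep
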